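{- Let $n\ge1$. For every signed composition $\alpha$ of $n$, $$\varphi(S_\alpha)=X_{|\alpha|},\qquad \varphi(T_\alpha)=\sum_{\underline{\alpha}\le\beta\le|\alpha|}Y_\beta,\qquad \varphi(\widetilde S_\alpha)=\sum_{U(\alpha)\le\beta\le O(\alpha)}Y_\beta,$$ the sums running over ordinary compositions $\beta$ of $n$. In particular $\varphi$ maps $\Omega(B_n)$ onto $\Sigma(A_{n-1})$.
   Context: Signed permutations: $\mathcal B_n$ consists of bijections $w$ of $\{\pm1,\dots,\pm n\}$ with $w(-i)=-w(i)$, written $w_1\cdots w_n$, entries ordered $\cdots<-2<-1<1<2<\cdots$. $\varphi:\mathbb Q\mathcal B_n\to\mathbb Q\mathcal S_n$ is the linear map forgetting signs. An ordinary composition $(b_1,\dots,b_h)$ of $n$ (positive integers summing to $n$) corresponds to the subset $\{b_1,b_1+b_2,\dots,b_1+\cdots+b_{h-1}\}$ of $\{1,\dots,n-1\}$; $\beta\le\gamma$ means the subset of $\beta$ is contained in that of $\gamma$. For a composition $\beta$ with subset $J$, $Y_\beta=\sum_{u\in\mathcal S_n,\mathrm{Des}(u)=J}u$ and $X_\beta=\sum_{\mathrm{Des}(u)\subseteq J}u$, where $\mathrm{Des}(u)=\{i:u_i>u_{i+1}\}$; $\Sigma(A_{n-1})$ is the span of these. For a composition $\gamma$ of $m$, $\gamma^c$ is the composition of $m$ whose subset is the complement in $\{1,\dots,m-1\}$. A signed composition of $n$ is a sequence $\alpha=(a_1,\dots,a_k)$ of nonzero integers with $\sum|a_i|=n$.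 Its segments are the maximal runs of consecutive parts of constant sign. $|\alpha|=(|a_1|,\dots,|a_k|)$. $\underline\alpha$: split $\{1,\dots,k\}$ into maximal intervals on which the signs of consecutive parts alternate; $\underline\alpha$ has one part $\sum_{i\in I}|a_i|$ for each such interval $I$, in order. $O(\alpha)$: replace each negative segment (with absolute sum $m$) by $m$ parts equal to $1$, and drop signs. $U(\alpha)$: replace each negative segment $\sigma$ (viewed, by absolute values, as an ordinary composition) by $\sigma^c$ with all parts negative, each positive segment by its single sum (positive), and then apply $\underline{\ \cdot\ }$ to the resulting signed composition. Consider the consecutive intervals of $\{1,\dots,n\}$ of lengths $|a_1|,\dots,|a_k|$. $\widetilde S_\alpha$ is the sum of all $w\in\mathcal B_n$ such that on each interval the entries $w_j$ are increasing and have sign equal to that of the corresponding $a_i$. $S_\alpha$ is the sum of all $w\in\mathcal B_n$ such that on each interval the values $|w_j|$ are increasing and the $w_j$ have sign equal to that of the corresponding $a_i$. $T_\alpha$ is the sum of those $w$ satisfying the conditions for $S_\alpha$ and for which these intervals are exactly the maximal intervals on which $|w_j|$ is increasing and the sign is constant. $\Omega(B_n)$ (the Mantaci–Reutenauer algebra) is the span of $\{T_\alpha\}$ over signed compositions $\alpha$ of $n$. -}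

module Defs where

open import Data.Bool using (Bool; true; false; not; _∧_; _∨_; _xor_; if_then_else_)
open import Data.Nat as ℕ using (ℕ; zero; suc; _∸_; _<ᵇ_; _≡ᵇ_; _<_)
open import Data.Integer as ℤ using (ℤ; +_; -[1+_]; ∣_∣; _◃_; _≤ᵇ_)
open import Data.Sign using (Sign)
open import Data.Fin using (Fin; toℕ)
open import Data.Fin.Permutation using (Permutation′; _⟨$⟩ʳ_)
open import Data.Vec.Functional using () renaming (_∷_ to _∷ᶠ_)
open import Data.List as List using (List; []; _∷_; _++_; map; concatMap; take; drop; replicate; upTo; length; zipWith)
open import Data.Bool.ListAction using (and; all; any)
open import Data.Nat.ListAction using (sum)
open import Data.List.Relation.Unary.All using (All)
open import Data.Rational as ℚ using (ℚ; 0ℚ; 1ℚ)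
open import Data.Product using (_×_; _,_; Σ; ∃)
open import Relation.Binary.PropositionalEquality using (_≡_; _≢_)

runs : {A : Set} → (A → A → Bool) → List A → List (List A)
runs R [] = []
runs R (x ∷ xs) = step (runs R xs)
  where
  step : _ → _
  step ((y ∷ g) ∷ gs) = if R x y then (x ∷ y ∷ g) ∷ gs else (x ∷ []) ∷ (y ∷ g) ∷ gs
  step gs = (x ∷ []) ∷ gs

chain : {A : Set} → (A → A → Bool) → List A → Bool
chain R (x ∷ y ∷ r) = R x y ∧ chain R (y ∷ r)
chain R _ = true

chunks : {A : Set} → List ℕ → List A → List (List A)
chunks [] w = []
chunks (b ∷ bs) w = take b w ∷ chunks bs (drop b w)

memᵇ : ℕ → List ℕ → Bool
memᵇ a B = any (a ≡ᵇ_) B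

subsetᵇ : List ℕ → List ℕ → Bool
subsetᵇ A B = all (λ a → memᵇ a B) A

eqListᵇ : List ℕ → List ℕ → Bool
eqListᵇ [] [] = true
eqListᵇ (x ∷ xs) (y ∷ ys) = (x ≡ᵇ y) ∧ eqListᵇ xs ys
eqListᵇ _ _ = false

sumℚ : List ℚ → ℚ
sumℚ = List.foldr ℚ._+_ 0ℚ

indicator : Bool → ℚ
indicator b = if b then 1ℚ else 0ℚ

IsComp : ℕ → List ℕ → Set
IsComp n β = All (λ b → 0 < b) β × sum β ≡ n

-- the subset {b1, b1+b2, ..., b1+...+b_{h-1}} of {1..n-1}
compSet : List ℕ → List ℕ
compSet [] = []
compSet (b ∷ []) = []
compSet (b ∷ c ∷ r) = b ∷ map (b ℕ.+_) (compSet (c ∷ r))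

_≤C_ : List ℕ → List ℕ → Bool
β ≤C γ = subsetᵇ (compSet β) (compSet γ)

-- the composition of m whose subset is S (S ⊆ {1..m-1}, sorted increasingly)
setToComp : ℕ → List ℕ → List ℕ
setToComp m S = diffs 0 (S ++ (m ∷ []))
  where
  diffs : ℕ → List ℕ → List ℕ
  diffs p [] = []
  diffs p (x ∷ xs) = (x ∸ p) ∷ diffs x xs

range1 : ℕ → List ℕ
range1 m = map suc (upTo (m ∸ 1))

compl : List ℕ → List ℕ
compl γ = setToComp m (List.filterᵇ (λ i → not (memᵇ i (compSet γ))) (range1 m))
  where m = sum γ

-- all ordinary compositions of n (each exactly once): a composition of
-- suc m arises from one of m by prepending a part 1 or by adding 1 to its
-- first part
comps : ℕ → List (List ℕ)
comps zero = [] ∷ []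
comps (suc m) = concatMap (λ c → (1 ∷ c) ∷ inc c) (comps m)
  where
  inc : List ℕ → List (List ℕ)
  inc [] = []
  inc (b ∷ r) = (suc b ∷ r) ∷ []

IsSignedComp : ℕ → List ℤ → Set
IsSignedComp n α = All (λ a → a ≢ + 0) α × sum (map ∣_∣ α) ≡ n

posᵇ : ℤ → Bool
posᵇ (+ suc _) = true
posᵇ _ = false

sameSignᵇ : ℤ → ℤ → Bool
sameSignᵇ a b = not (posᵇ a xor posᵇ b)

absC : List ℤ → List ℕ
absC α = map ∣_∣ α

segments : List ℤ → List (List ℤ)
segments = runs sameSignᵇ

under : List ℤ → List ℕ
under α = map (λ I → sum (map ∣_∣ I)) (runs (λ a b → not (sameSignᵇ a b)) α)

O : List ℤ → List ℕ
O α = concatMap oseg (segments α)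
  where
  oseg : List ℤ → List ℕ
  oseg σ = if all posᵇ σ then map ∣_∣ σ else replicate (sum (map ∣_∣ σ)) 1

U : List ℤ → List ℕ
U α = under (concatMap useg (segments α))
  where
  useg : List ℤ → List ℤ
  useg σ = if all posᵇ σ then (+ sum (map ∣_∣ σ)) ∷ []
           else map (λ b → ℤ.- (+ b)) (compl (map ∣_∣ σ))

-- Signed permutations: w ∈ B_n is determined by its window w_1 ... w_n,
-- i.e. by the permutation |w| ∈ S_n together with the signs of the w_j.

SPerm : ℕ → Set
SPerm n = (Fin n → Sign) × Permutation′ n

-- the window w_1 ... w_n as integers (value j+1 for Fin index j)
swordOf : {n : ℕ} → SPerm n → List ℤ
swordOf (ε , u) = List.tabulate (λ j → ε j ◃ suc (toℕ (u ⟨$⟩ʳ j)))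

wordOf : {n : ℕ} → Permutation′ n → List ℕ
wordOf u = List.tabulate (λ j → suc (toℕ (u ⟨$⟩ʳ j)))

-- elements of the group algebras, as coefficient functions
QB : ℕ → Set
QB n = SPerm n → ℚ

QS : ℕ → Set
QS n = Permutation′ n → ℚ

allSigns : (n : ℕ) → List (Fin n → Sign)
allSigns zero = (λ ()) ∷ []
allSigns (suc n) = concatMap (λ f → (Sign.+ ∷ᶠ f) ∷ (Sign.- ∷ᶠ f) ∷ []) (allSigns n)

-- φ : ℚB_n → ℚS_n, linear extension of w ↦ |w|
φ : {n : ℕ} → QB n → QS n
φ {n} x u = sumℚ (map (λ ε → x (ε , u)) (allSigns n))

-- Des(u) ⊆ {1..n-1}, 1-based positions i with u_i > u_{i+1}
des : List ℕ → List ℕ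
des (x ∷ y ∷ r) = (if y <ᵇ x then 1 ∷ [] else []) ++ map suc (des (y ∷ r))
des _ = []

Y : {n : ℕ} → List ℕ → QS n
Y β u = indicator (subsetᵇ (des (wordOf u)) (compSet β) ∧ subsetᵇ (compSet β) (des (wordOf u)))

X : {n : ℕ} → List ℕ → QS n
X β u = indicator (subsetᵇ (des (wordOf u)) (compSet β))

sumY : (n : ℕ) → (List ℕ → Bool) → QS n
sumY n P u = sumℚ (map (λ β → if P β then Y β u else 0ℚ) (comps n))

ltℤ : ℤ → ℤ → Bool
ltℤ x y = not (y ≤ᵇ x)

blockCond : (ℤ → ℤ → Bool) → List ℤ → List ℤ → Bool
blockCond R α w = and (zipWith (λ a c → chain R c ∧ all (sameSignᵇ a) c) α (chunks (absC α) w))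

St : {n : ℕ} → List ℤ → QB n
St α w = indicator (blockCond ltℤ α (swordOf w))

S : {n : ℕ} → List ℤ → QB n
S α w = indicator (blockCond (λ x y → ∣ x ∣ <ᵇ ∣ y ∣) α (swordOf w))

stepᵇ : ℤ → ℤ → Bool
stepᵇ x y = sameSignᵇ x y ∧ (∣ x ∣ <ᵇ ∣ y ∣)

T : {n : ℕ} → List ℤ → QB n
T α w = indicator (blockCond (λ x y → ∣ x ∣ <ᵇ ∣ y ∣) α (swordOf w)
                   ∧ eqListᵇ (map length (runs stepᵇ (swordOf w))) (absC α))

InΩ : (n : ℕ) → QB n → Set
InΩ n x = Σ (List (ℚ × List ℤ)) λ L →
  All (λ p → IsSignedComp n (Data.Product.proj₂ p)) L ×
  (∀ w → x w ≡ sumℚ (map (λ p → Data.Product.proj₁ p ℚ.* T (Data.Product.proj₂ p) w) L))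

InΣ : (n : ℕ) → QS n → Set
InΣ n y = Σ (List (ℚ × List ℕ)) λ L → Σ (List (ℚ × List ℕ)) λ M →
  All (λ p → IsComp n (Data.Product.proj₂ p)) L ×
  All (λ p → IsComp n (Data.Product.proj₂ p)) M ×
  (∀ u → y u ≡ sumℚ (map (λ p → Data.Product.proj₁ p ℚ.* Y (Data.Product.proj₂ p) u) L)
              ℚ.+ sumℚ (map (λ p → Data.Product.proj₁ p ℚ.* X (Data.Product.proj₂ p) u) M))

{-# OPTIONS --safe #-}
module Submission where

-- Each of S_α, T_α, S̃_α is a sum of signed permutations w whose signs are those of the parts of α,
-- so at u ∈ S_n its image under φ is the truth value of a condition on one signed window: |w| = u
-- with the sign pattern of α. That condition is a conjunction over the n − 1 gaps between adjacent
-- positions, each conjunct depending only on whether the gap separates two parts of α, on the signs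
-- of the parts beside it, and on whether u descends there. Encoding a composition of n by its subset
-- of {1, …, n − 1} as a bit list indexed by these gaps, |α|, α̲, O(α) and U(α) become per-gap bits,
-- and gap by gap the condition is Des(u) ⊆ |α|, resp. α̲ ⊆ Des(u) ⊆ |α|, resp. U(α) ⊆ Des(u) ⊆ O(α).
-- Exactly one Y_β is nonzero at u, namely the one with β ↔ Des(u), which gives the three formulas.
-- Surjectivity: Y_β = φ(T_β) for β with positive parts, and X_β = φ(T_β′) for β′ with parts of
-- absolute values β and alternating signs.

open import Defs
open import Algebra.Bundles using (CommutativeMonoid)
import Algebra.Properties.CommutativeSemigroup as CommutativeSemigroupProperties
open import Data.Bool using (Bool; true; false; not; _∧_; _∨_; if_then_else_)
open import Data.Bool.ListAction using (and; all)
open import Data.Bool.Properties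
  using (∧-identityʳ; ∧-zeroʳ; ∧-assoc; ∧-comm; ∧-conicalˡ; ∧-conicalʳ; ∧-commutativeMonoid;
         ∨-comm; ∨-zeroʳ; ∨-identityʳ; not-involutive; not-injective)
open import Data.Fin as Fin using (Fin; toℕ)
open import Data.Fin.Permutation using (Permutation′; _⟨$⟩ʳ_)
open import Data.Fin.Properties using (toℕ-injective)
open import Data.Integer as ℤ using (ℤ; +_; -[1+_]; -1ℤ; ∣_∣; _◃_; sign)
open import Data.Integer.Properties using (sign-◃; abs-◃)
open import Data.List as List using (List; []; _∷_; _++_; map; replicate; length; zipWith; take; drop)
open import Data.List.Properties
  using (map-++; map-replicate; map-∘; map-id; map-cong; map-upTo; map-tabulate; ++-assoc; ++-identityʳ;
         ∷-injective; drop-[]; take++drop≡id; take-map; drop-map;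
         length-map; length-take; length-drop; length-tabulate; length-++; length-replicate)
import Data.List.Relation.Unary.All as All
open import Data.List.Relation.Unary.All using (All; []; _∷_)
open import Data.List.Relation.Unary.All.Properties using (++⁺; ++⁻ˡ; replicate⁺; map⁺; take⁺; drop⁺; concat⁺)
open import Data.List.Relation.Unary.Linked using (Linked; _∷_)
open import Data.List.Relation.Unary.Linked.Properties using (AllPairs⇒Linked)
import Data.List.Relation.Unary.Unique.Propositional.Properties as Unique
open import Data.Nat as ℕ using (ℕ; zero; suc; _+_; _∸_; _<_; _≤_; z≤n; s≤s; _≡ᵇ_; _<ᵇ_)
open import Data.Nat.ListAction using (sum)
open import Data.Nat.Properties using (suc-injective; +-identityʳ; +-suc; m≤n⇒m⊓n≡m; m≤m+n; m+n∸m≡n)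
open import Data.Product using (_×_; _,_; Σ; ∃₂; proj₁; proj₂)
open import Data.Rational as ℚ using (ℚ; 0ℚ; 1ℚ)
import Data.Rational.Properties as ℚₚ
open import Data.Sign as Sign using (Sign)
open import Data.Unit using (⊤; tt)
open import Data.Vec.Functional using () renaming (_∷_ to _∷ᶠ_)
open import Function using (_∘_)
open import Function.Bundles using (Injection)
open import Function.Properties.Inverse using (↔⇒↣)
open import Relation.Binary.PropositionalEquality
open import Relation.Nullary using (contradiction)

module ∧ₚ = CommutativeSemigroupProperties (CommutativeMonoid.commutativeSemigroup ∧-commutativeMonoid)
module +ₚ = CommutativeSemigroupProperties (CommutativeMonoid.commutativeSemigroup ℚₚ.+-0-commutativeMonoid)

all-++ : ∀ {A : Set} (p : A → Bool) xs ys → all p (xs ++ ys) ≡ all p xs ∧ all p ys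
all-++ p [] ys = refl
all-++ p (x ∷ xs) ys = trans (cong (p x ∧_) (all-++ p xs ys)) (sym (∧-assoc (p x) _ _))

all-map : ∀ {A B : Set} (p : B → Bool) (f : A → B) xs → all p (map f xs) ≡ all (p ∘ f) xs
all-map p f [] = refl
all-map p f (x ∷ xs) = cong (p (f x) ∧_) (all-map p f xs)

-- 1-based, the convention of compSet and des
truePositions : List Bool → List ℕ
truePositions [] = []
truePositions (b ∷ bs) = (if b then 1 ∷ [] else []) ++ map suc (truePositions bs)

_⊆ᵇ_ : List Bool → List Bool → Bool
A ⊆ᵇ B = and (zipWith (λ a b → not a ∨ b) A B)

bitAt : List Bool → ℕ → Bool
bitAt [] _ = false
bitAt (b ∷ bs) zero = b
bitAt (b ∷ bs) (suc i) = bitAt bs i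

allAt : (ℕ → Bool) → List Bool → Bool
allAt f [] = true
allAt f (a ∷ as) = (not a ∨ f 0) ∧ allAt (f ∘ suc) as

all-truePositions : ∀ f A → all f (truePositions A) ≡ allAt (f ∘ suc) A
all-truePositions f [] = refl
all-truePositions f (a ∷ A) =
  trans (all-++ f (if a then 1 ∷ [] else []) (map suc (truePositions A)))
        (cong₂ _∧_ (head a) (trans (all-map f suc (truePositions A)) (all-truePositions (f ∘ suc) A)))
  where
  head : ∀ a → all f (if a then 1 ∷ [] else []) ≡ not a ∨ f 1
  head true = ∧-identityʳ (f 1)
  head false = refl

allAt-cong : ∀ {f g} A → (∀ i → f i ≡ g i) → allAt f A ≡ allAt g A
allAt-cong [] f≗g = refl
allAt-cong (a ∷ A) f≗g = cong₂ (λ x y → (not a ∨ x) ∧ y) (f≗g 0) (allAt-cong A (f≗g ∘ suc))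

allAt-bitAt : ∀ A B → length A ≡ length B → allAt (bitAt B) A ≡ A ⊆ᵇ B
allAt-bitAt [] [] _ = refl
allAt-bitAt (a ∷ A) (b ∷ B) eq = cong ((not a ∨ b) ∧_) (allAt-bitAt A B (suc-injective eq))

memᵇ-map-suc : ∀ i xs → memᵇ (suc i) (map suc xs) ≡ memᵇ i xs
memᵇ-map-suc i [] = refl
memᵇ-map-suc i (x ∷ xs) = cong ((i ≡ᵇ x) ∨_) (memᵇ-map-suc i xs)

memᵇ-zero-map-suc : ∀ xs → memᵇ 0 (map suc xs) ≡ false
memᵇ-zero-map-suc [] = refl
memᵇ-zero-map-suc (x ∷ xs) = memᵇ-zero-map-suc xs

memᵇ-truePositions : ∀ C i → memᵇ (suc i) (truePositions C) ≡ bitAt C i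
memᵇ-truePositions [] i = refl
memᵇ-truePositions (true ∷ C) zero = refl
memᵇ-truePositions (false ∷ C) zero = trans (memᵇ-map-suc 0 (truePositions C)) (memᵇ-zero-truePositions C)
  where
  memᵇ-zero-truePositions : ∀ C → memᵇ 0 (truePositions C) ≡ false
  memᵇ-zero-truePositions [] = refl
  memᵇ-zero-truePositions (true ∷ C) = memᵇ-zero-map-suc (truePositions C)
  memᵇ-zero-truePositions (false ∷ C) = memᵇ-zero-map-suc (truePositions C)
memᵇ-truePositions (true ∷ C) (suc i) = trans (memᵇ-map-suc (suc i) (truePositions C)) (memᵇ-truePositions C i)
memᵇ-truePositions (false ∷ C) (suc i) = trans (memᵇ-map-suc (suc i) (truePositions C)) (memᵇ-truePositions C i)

subsetᵇ-truePositions : ∀ A B → length A ≡ length B →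
  subsetᵇ (truePositions A) (truePositions B) ≡ A ⊆ᵇ B
subsetᵇ-truePositions A B eq = begin
  all (λ i → memᵇ i (truePositions B)) (truePositions A) ≡⟨ all-truePositions _ A ⟩
  allAt (λ i → memᵇ (suc i) (truePositions B)) A        ≡⟨ allAt-cong A (memᵇ-truePositions B) ⟩
  allAt (bitAt B) A                                      ≡⟨ allAt-bitAt A B eq ⟩
  A ⊆ᵇ B                                                 ∎
  where open ≡-Reasoning

⊆ᵇ-refl : ∀ A → A ⊆ᵇ A ≡ true
⊆ᵇ-refl [] = refl
⊆ᵇ-refl (true ∷ A) = ⊆ᵇ-refl A
⊆ᵇ-refl (false ∷ A) = ⊆ᵇ-refl A

⊆ᵇ-antisym : ∀ A B → length A ≡ length B → A ⊆ᵇ B ∧ B ⊆ᵇ A ≡ true → A ≡ B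
⊆ᵇ-antisym [] [] _ _ = refl
⊆ᵇ-antisym (true ∷ A) (true ∷ B) eq h = cong (true ∷_) (⊆ᵇ-antisym A B (suc-injective eq) h)
⊆ᵇ-antisym (false ∷ A) (false ∷ B) eq h = cong (false ∷_) (⊆ᵇ-antisym A B (suc-injective eq) h)
⊆ᵇ-antisym (true ∷ A) (false ∷ B) eq ()
⊆ᵇ-antisym (false ∷ A) (true ∷ B) eq h = contradiction (trans (sym (∧-zeroʳ (A ⊆ᵇ B))) h) λ ()

adjacentBits : {A : Set} → (A → A → Bool) → List A → List Bool
adjacentBits D (x ∷ y ∷ r) = D x y ∷ adjacentBits D (y ∷ r)
adjacentBits D _ = []

length-adjacentBits : ∀ {A : Set} (D : A → A → Bool) xs → length (adjacentBits D xs) ≡ length xs ∸ 1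
length-adjacentBits D [] = refl
length-adjacentBits D (x ∷ []) = refl
length-adjacentBits D (x ∷ y ∷ r) = cong suc (length-adjacentBits D (y ∷ r))

adjacentBits-map : ∀ {A B : Set} (D : B → B → Bool) (h : A → B) xs →
  adjacentBits D (map h xs) ≡ adjacentBits (λ x y → D (h x) (h y)) xs
adjacentBits-map D h [] = refl
adjacentBits-map D h (x ∷ []) = refl
adjacentBits-map D h (x ∷ y ∷ r) = cong (D (h x) (h y) ∷_) (adjacentBits-map D h (y ∷ r))

descentBits : List ℕ → List Bool
descentBits = adjacentBits (λ x y → y <ᵇ x)

des-descentBits : ∀ w → des w ≡ truePositions (descentBits w)
des-descentBits [] = refl
des-descentBits (x ∷ []) = refl
des-descentBits (x ∷ y ∷ r) = cong (λ P → (if y <ᵇ x then 1 ∷ [] else []) ++ map suc P) (des-descentBits (y ∷ r))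

-- Item x occupies w x consecutive positions; inner x labels the w x ∸ 1 gaps inside it and
-- between x y the gap from x to the next item y.
gapList : {A B : Set} → (A → ℕ) → (A → B) → (A → A → B) → List A → List B
gapList w inner between [] = []
gapList w inner between (x ∷ []) = replicate (w x ∸ 1) (inner x)
gapList w inner between (x ∷ y ∷ r) =
  replicate (w x ∸ 1) (inner x) ++ between x y ∷ gapList w inner between (y ∷ r)

map-gapList : ∀ {A B C : Set} (f : B → C) w (inner : A → B) between xs →
  map f (gapList w inner between xs) ≡ gapList w (f ∘ inner) (λ x y → f (between x y)) xs
map-gapList f w inner between [] = refl
map-gapList f w inner between (x ∷ []) = map-replicate f (w x ∸ 1) (inner x)
map-gapList f w inner between (x ∷ y ∷ r) =
  trans (map-++ f (replicate (w x ∸ 1) (inner x)) _)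
        (cong₂ _++_ (map-replicate f (w x ∸ 1) (inner x))
                    (cong (f (between x y) ∷_) (map-gapList f w inner between (y ∷ r))))

gapList-cong : ∀ {A B : Set} w (inner : A → B) {between between′} → (∀ x y → between x y ≡ between′ x y) →
  ∀ xs → gapList w inner between xs ≡ gapList w inner between′ xs
gapList-cong w inner b≗b′ [] = refl
gapList-cong w inner b≗b′ (x ∷ []) = refl
gapList-cong w inner b≗b′ (x ∷ y ∷ r) =
  cong (replicate (w x ∸ 1) (inner x) ++_) (cong₂ _∷_ (b≗b′ x y) (gapList-cong w inner b≗b′ (y ∷ r)))

length-gapList : ∀ {A B : Set} w (inner : A → B) between x xs → All (λ y → 1 ≤ w y) (x ∷ xs) →
  suc (length (gapList w inner between (x ∷ xs))) ≡ sum (map w (x ∷ xs))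
length-gapList w inner between x [] (p ∷ []) with w x | p
... | suc k | _ = cong suc (trans (length-replicate k) (sym (+-identityʳ k)))
length-gapList w inner between x (y ∷ xs) (p ∷ ps) with w x | p
... | suc k | _ = cong suc (begin
  length (replicate k (inner x) ++ between x y ∷ gapList w inner between (y ∷ xs))
    ≡⟨ length-++ (replicate k (inner x)) ⟩
  length (replicate k (inner x)) + suc (length (gapList w inner between (y ∷ xs)))
    ≡⟨ cong₂ _+_ (length-replicate k) (length-gapList w inner between y xs ps) ⟩
  k + sum (map w (y ∷ xs)) ∎)
  where open ≡-Reasoning

incHead : List ℕ → List ℕ
incHead [] = []
incHead (x ∷ r) = suc x ∷ r

bitsToComp : List Bool → List ℕ
bitsToComp [] = 1 ∷ []
bitsToComp (true ∷ bs) = 1 ∷ bitsToComp bs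
bitsToComp (false ∷ bs) = incHead (bitsToComp bs)

compToBits : List ℕ → List Bool
compToBits = gapList (λ b → b) (λ _ → false) (λ _ _ → true)

bitsToComp-head : ∀ B → ∃₂ λ h t → bitsToComp B ≡ suc h ∷ t
bitsToComp-head [] = 0 , [] , refl
bitsToComp-head (true ∷ B) = 0 , bitsToComp B , refl
bitsToComp-head (false ∷ B) with bitsToComp B | bitsToComp-head B
... | _ | h , t , refl = suc h , t , refl

compSet-incHead : ∀ x r → compSet (incHead (x ∷ r)) ≡ map suc (compSet (x ∷ r))
compSet-incHead x [] = refl
compSet-incHead x (c ∷ r) = cong (suc x ∷_) (map-∘ (compSet (c ∷ r)))

compSet-bitsToComp : ∀ B → compSet (bitsToComp B) ≡ truePositions B
compSet-bitsToComp [] = refl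
compSet-bitsToComp (true ∷ B) with bitsToComp B | bitsToComp-head B | compSet-bitsToComp B
... | _ | h , t , refl | ih = cong (1 ∷_) (cong (map suc) ih)
compSet-bitsToComp (false ∷ B) with bitsToComp B | bitsToComp-head B | compSet-bitsToComp B
... | _ | h , t , refl | ih = trans (compSet-incHead (suc h) t) (cong (map suc) ih)

≤C-bitsToComp : ∀ A B → length A ≡ length B → (bitsToComp A ≤C bitsToComp B) ≡ A ⊆ᵇ B
≤C-bitsToComp A B eq = trans (cong₂ subsetᵇ (compSet-bitsToComp A) (compSet-bitsToComp B)) (subsetᵇ-truePositions A B eq)

sum-bitsToComp : ∀ B → sum (bitsToComp B) ≡ suc (length B)
sum-bitsToComp [] = refl
sum-bitsToComp (true ∷ B) = cong suc (sum-bitsToComp B)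
sum-bitsToComp (false ∷ B) with bitsToComp B | bitsToComp-head B | sum-bitsToComp B
... | _ | h , t , refl | ih = cong suc ih

bitsToComp-positive : ∀ B → All (0 <_) (bitsToComp B)
bitsToComp-positive [] = s≤s z≤n ∷ []
bitsToComp-positive (true ∷ B) = s≤s z≤n ∷ bitsToComp-positive B
bitsToComp-positive (false ∷ B) with bitsToComp B | bitsToComp-head B | bitsToComp-positive B
... | _ | h , t , refl | _ ∷ ps = s≤s z≤n ∷ ps

bitsToComp-falses : ∀ k → bitsToComp (replicate k false) ≡ suc k ∷ []
bitsToComp-falses zero = refl
bitsToComp-falses (suc k) = cong incHead (bitsToComp-falses k)

bitsToComp-falses-true : ∀ k B → bitsToComp (replicate k false ++ true ∷ B) ≡ suc k ∷ bitsToComp B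
bitsToComp-falses-true zero B = refl
bitsToComp-falses-true (suc k) B = cong incHead (bitsToComp-falses-true k B)

addHead : ℕ → List ℕ → List ℕ
addHead k [] = []
addHead k (h ∷ t) = k + h ∷ t

bitsToComp-falses-++ : ∀ k B → bitsToComp (replicate k false ++ B) ≡ addHead k (bitsToComp B)
bitsToComp-falses-++ zero B with bitsToComp B
... | [] = refl
... | h ∷ t = refl
bitsToComp-falses-++ (suc k) B rewrite bitsToComp-falses-++ k B with bitsToComp B
... | [] = refl
... | h ∷ t = refl

bitsToComp-trues : ∀ k → bitsToComp (replicate k true) ≡ replicate (suc k) 1
bitsToComp-trues zero = refl
bitsToComp-trues (suc k) = cong (1 ∷_) (bitsToComp-trues k)

bitsToComp-trues-++ : ∀ k B → bitsToComp (replicate k true ++ B) ≡ replicate k 1 ++ bitsToComp B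
bitsToComp-trues-++ zero B = refl
bitsToComp-trues-++ (suc k) B = cong (1 ∷_) (bitsToComp-trues-++ k B)

bitsToComp-parts : ∀ {A : Set} (w : A → ℕ) x xs → All (λ y → 1 ≤ w y) (x ∷ xs) →
  bitsToComp (gapList w (λ _ → false) (λ _ _ → true) (x ∷ xs)) ≡ map w (x ∷ xs)
bitsToComp-parts w x [] (p ∷ []) with w x | p
... | suc k | _ = bitsToComp-falses k
bitsToComp-parts w x (y ∷ xs) (p ∷ ps) with w x | p
... | suc k | _ = trans (bitsToComp-falses-true k _) (cong (suc k ∷_) (bitsToComp-parts w y xs ps))

bitsToComp-compToBits : ∀ {n} β → IsComp (suc n) β → bitsToComp (compToBits β) ≡ β
bitsToComp-compToBits [] (_ , ())
bitsToComp-compToBits (b ∷ β) (ps , _) = trans (bitsToComp-parts (λ b → b) b β ps) (map-id (b ∷ β))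

length-compToBits : ∀ {n} β → IsComp (suc n) β → length (compToBits β) ≡ n
length-compToBits [] (_ , ())
length-compToBits (b ∷ β) (ps , s) =
  suc-injective (trans (length-gapList (λ b → b) _ _ b β ps) (trans (cong sum (map-id (b ∷ β))) s))

eqListᵇ-bitsToComp : ∀ A B → length A ≡ length B → eqListᵇ (bitsToComp A) (bitsToComp B) ≡ A ⊆ᵇ B ∧ B ⊆ᵇ A
eqListᵇ-bitsToComp [] [] _ = refl
eqListᵇ-bitsToComp (true ∷ A) (true ∷ B) eq = eqListᵇ-bitsToComp A B (suc-injective eq)
eqListᵇ-bitsToComp (true ∷ A) (false ∷ B) eq with bitsToComp B | bitsToComp-head B
... | _ | h , t , refl = refl
eqListᵇ-bitsToComp (false ∷ A) (true ∷ B) eq with bitsToComp A | bitsToComp-head A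
... | _ | h , t , refl = sym (∧-zeroʳ (A ⊆ᵇ B))
eqListᵇ-bitsToComp (false ∷ A) (false ∷ B) eq
  with bitsToComp A | bitsToComp-head A | bitsToComp B | bitsToComp-head B | eqListᵇ-bitsToComp A B (suc-injective eq)
... | _ | h , t , refl | _ | h′ , t′ , refl | ih = ih

differences : ℕ → List ℕ → List ℕ
differences p [] = []
differences p (x ∷ xs) = (x ∸ p) ∷ differences x xs

setToComp-differences : ∀ m S → setToComp m S ≡ differences 0 (S ++ m ∷ [])
setToComp-differences m [] = refl
setToComp-differences m (x ∷ S) = cong (x ∷_) (tail-setToComp x S)
  where
  tail : List ℕ → List ℕ
  tail [] = []
  tail (_ ∷ r) = r
  tail-setToComp : ∀ p L → tail (setToComp m (p ∷ L)) ≡ differences p (L ++ m ∷ [])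
  tail-setToComp p [] = refl
  tail-setToComp p (x ∷ L) = cong ((x ∸ p) ∷_) (tail-setToComp x L)

differences-map-suc : ∀ p L → differences (suc p) (map suc L) ≡ differences p L
differences-map-suc p [] = refl
differences-map-suc p (x ∷ L) = cong ((x ∸ p) ∷_) (differences-map-suc x L)

setToComp-truePositions : ∀ C → setToComp (suc (length C)) (truePositions C) ≡ bitsToComp C
setToComp-truePositions C = trans (setToComp-differences _ (truePositions C)) (differences-truePositions C)
  where
  differences-incHead : ∀ Y m → differences 0 (map suc (Y ++ m ∷ [])) ≡ incHead (differences 0 (Y ++ m ∷ []))
  differences-incHead [] m = refl
  differences-incHead (y ∷ ys) m = cong (suc y ∷_) (differences-map-suc y (ys ++ m ∷ []))
  differences-truePositions : ∀ C → differences 0 (truePositions C ++ suc (length C) ∷ []) ≡ bitsToComp C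
  differences-truePositions [] = refl
  differences-truePositions (true ∷ C) =
    cong (1 ∷_) (trans (cong (differences 1) (sym (map-++ suc (truePositions C) _)))
                (trans (differences-map-suc 0 _) (differences-truePositions C)))
  differences-truePositions (false ∷ C) =
    trans (cong (differences 0) (sym (map-++ suc (truePositions C) _)))
          (trans (differences-incHead (truePositions C) _) (cong incHead (differences-truePositions C)))

filterᵇ-applyUpTo : ∀ C (f : ℕ → ℕ) q → (∀ i → i < length C → q (f (suc i)) ≡ bitAt C i) →
  List.filterᵇ q (List.applyUpTo (f ∘ suc) (length C)) ≡ map f (truePositions C)
filterᵇ-applyUpTo [] f q h = refl
filterᵇ-applyUpTo (c ∷ C) f q h =
  trans (filterᵇ-∷ (h 0 (s≤s z≤n))) (trans (cong (λ t → if c then f 1 ∷ t else t) rest) (sym (select c)))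
  where
  filterᵇ-∷ : ∀ {x xs b} → q x ≡ b →
    List.filterᵇ q (x ∷ xs) ≡ (if b then x ∷ List.filterᵇ q xs else List.filterᵇ q xs)
  filterᵇ-∷ {x} refl with q x
  ... | true = refl
  ... | false = refl
  rest : List.filterᵇ q (List.applyUpTo (f ∘ suc ∘ suc) (length C)) ≡ map f (map suc (truePositions C))
  rest = trans (filterᵇ-applyUpTo C (f ∘ suc) q (λ i i< → h (suc i) (s≤s i<))) (map-∘ (truePositions C))
  select : ∀ c → map f (truePositions (c ∷ C))
               ≡ (if c then f 1 ∷ map f (map suc (truePositions C)) else map f (map suc (truePositions C)))
  select true = refl
  select false = refl

compl-bitsToComp : ∀ C → compl (bitsToComp C) ≡ bitsToComp (map not C)
compl-bitsToComp C rewrite sum-bitsToComp C | compSet-bitsToComp C = begin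
  setToComp (suc (length C)) (List.filterᵇ (λ i → not (memᵇ i (truePositions C))) (map suc (List.upTo (length C))))
    ≡⟨ cong (setToComp (suc (length C))) complement ⟩
  setToComp (suc (length C)) (truePositions (map not C))
    ≡⟨ cong (λ l → setToComp (suc l) (truePositions (map not C))) (sym (length-map not C)) ⟩
  setToComp (suc (length (map not C))) (truePositions (map not C))
    ≡⟨ setToComp-truePositions (map not C) ⟩
  bitsToComp (map not C) ∎
  where
  open ≡-Reasoning
  bitAt-map-not : ∀ C i → i < length C → not (bitAt C i) ≡ bitAt (map not C) i
  bitAt-map-not (b ∷ C) zero _ = refl
  bitAt-map-not (b ∷ C) (suc i) (s≤s i<) = bitAt-map-not C i i<
  complement : List.filterᵇ (λ i → not (memᵇ i (truePositions C))) (map suc (List.upTo (length C)))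
             ≡ truePositions (map not C)
  complement = begin
    List.filterᵇ q (map suc (List.upTo (length C)))          ≡⟨ cong (List.filterᵇ q) (map-upTo suc (length C)) ⟩
    List.filterᵇ q (List.applyUpTo suc (length C))           ≡⟨ cong (λ l → List.filterᵇ q (List.applyUpTo suc l)) (sym (length-map not C)) ⟩
    List.filterᵇ q (List.applyUpTo suc (length (map not C))) ≡⟨ filterᵇ-applyUpTo (map not C) (λ i → i) q bits ⟩
    map (λ i → i) (truePositions (map not C))                ≡⟨ map-id _ ⟩
    truePositions (map not C)                                ∎
    where
    q : ℕ → Bool
    q i = not (memᵇ i (truePositions C))
    bits : ∀ i → i < length (map not C) → not (memᵇ (suc i) (truePositions C)) ≡ bitAt (map not C) i
    bits i i< = trans (cong not (memᵇ-truePositions C i)) (bitAt-map-not C i (subst (i <_) (length-map not C) i<))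

compl-head : ∀ {n} γ → IsComp (suc n) γ → ∃₂ λ h t → compl γ ≡ suc h ∷ t
compl-head γ ic with bitsToComp-head (map not (compToBits γ))
... | h , t , e = h , t , trans (cong compl (sym (bitsToComp-compToBits γ ic)))
                                (trans (compl-bitsToComp (compToBits γ)) e)

compl-∷ : ∀ {n} k γ → IsComp (suc n) γ → compl (suc k ∷ γ) ≡ replicate k 1 ++ incHead (compl γ)
compl-∷ k γ ic = begin
  compl (suc k ∷ γ)                                    ≡⟨ cong (λ γ′ → compl (suc k ∷ γ′)) (sym γ≡) ⟩
  compl (suc k ∷ bitsToComp C)                         ≡⟨ cong compl (sym (bitsToComp-falses-true k C)) ⟩
  compl (bitsToComp (replicate k false ++ true ∷ C))   ≡⟨ compl-bitsToComp (replicate k false ++ true ∷ C) ⟩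
  bitsToComp (map not (replicate k false ++ true ∷ C)) ≡⟨ cong bitsToComp (map-++ not (replicate k false) (true ∷ C)) ⟩
  bitsToComp (map not (replicate k false) ++ false ∷ map not C)
    ≡⟨ cong (λ l → bitsToComp (l ++ false ∷ map not C)) (map-replicate not k false) ⟩
  bitsToComp (replicate k true ++ false ∷ map not C)  ≡⟨ bitsToComp-trues-++ k (false ∷ map not C) ⟩
  replicate k 1 ++ incHead (bitsToComp (map not C))   ≡⟨ cong (λ l → replicate k 1 ++ incHead l) (sym (compl-bitsToComp C)) ⟩
  replicate k 1 ++ incHead (compl (bitsToComp C))     ≡⟨ cong (λ γ′ → replicate k 1 ++ incHead (compl γ′)) γ≡ ⟩
  replicate k 1 ++ incHead (compl γ)                  ∎
  where
  open ≡-Reasoning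
  C = compToBits γ
  γ≡ : bitsToComp C ≡ γ
  γ≡ = bitsToComp-compToBits γ ic

runs-head : ∀ {A : Set} (R : A → A → Bool) x xs →
  ∃₂ λ g gs → runs R (x ∷ xs) ≡ (x ∷ g) ∷ gs × chain R (x ∷ g) ≡ true
runs-head R x [] = [] , [] , refl , refl
runs-head R x (y ∷ ys) with runs R (y ∷ ys) | runs-head R y ys
... | _ | g , gs , refl , ch with R x y in Rxy
...   | true = y ∷ g , gs , refl , trans (cong (_∧ chain R (y ∷ g)) Rxy) ch
...   | false = [] , (y ∷ g) ∷ gs , refl , refl

runs-concat : ∀ {A : Set} (R : A → A → Bool) xs → List.concat (runs R xs) ≡ xs
runs-concat R [] = refl
runs-concat R (x ∷ xs) with runs R xs | runs-concat R xs
... | [] | refl = refl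
... | [] ∷ gs | refl = refl
... | (y ∷ g) ∷ gs | refl with R x y
...   | true = refl
...   | false = refl

runs-chain : ∀ {A : Set} (R : A → A → Bool) x xs → chain R (x ∷ xs) ≡ true → runs R (x ∷ xs) ≡ (x ∷ xs) ∷ []
runs-chain R x [] _ = refl
runs-chain R x (y ∷ ys) ch rewrite runs-chain R y ys (∧-conicalʳ _ _ ch) | ∧-conicalˡ (R x y) _ ch = refl

runs-antichain : ∀ {A : Set} (R : A → A → Bool) xs → chain (λ x y → not (R x y)) xs ≡ true →
  runs R xs ≡ map (_∷ []) xs
runs-antichain R [] _ = refl
runs-antichain R (x ∷ []) _ = refl
runs-antichain R (x ∷ y ∷ ys) ch
  rewrite runs-antichain R (y ∷ ys) (∧-conicalʳ _ _ ch) | not-injective (∧-conicalˡ (not (R x y)) _ ch) = refl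

sum-runs : ∀ {A : Set} (w : A → ℕ) (R : A → A → Bool) x xs → All (λ y → 1 ≤ w y) (x ∷ xs) →
  map (sum ∘ map w) (runs R (x ∷ xs)) ≡ bitsToComp (gapList w (λ _ → false) (λ y z → not (R y z)) (x ∷ xs))
sum-runs w R x [] (p ∷ []) with w x | p
... | suc k | _ = trans (cong (_∷ []) (+-identityʳ (suc k))) (sym (bitsToComp-falses k))
sum-runs w R x (y ∷ ys) (p ∷ ps) with runs R (y ∷ ys) | runs-head R y ys | sum-runs w R y ys ps
... | _ | g , gs , refl , _ | ih with R x y
...   | true with w x | p
...     | suc k | _ =
  trans (cong (_∷ map (sum ∘ map w) gs) (sym (+-suc k (sum (map w (y ∷ g))))))
        (trans (cong (addHead k ∘ incHead) ih) (sym (bitsToComp-falses-++ k (false ∷ _))))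
sum-runs w R x (y ∷ ys) (p ∷ ps) | _ | g , gs , refl , _ | ih | false with w x | p
...     | suc k | _ =
  trans (cong₂ _∷_ (+-identityʳ (suc k)) ih) (sym (bitsToComp-falses-true k _))

map-length-runs : ∀ {A : Set} (R : A → A → Bool) x xs →
  map length (runs R (x ∷ xs)) ≡ bitsToComp (adjacentBits (λ y z → not (R y z)) (x ∷ xs))
map-length-runs R x xs = begin
  map length (runs R (x ∷ xs))
    ≡⟨ map-cong length≡sum-ones (runs R (x ∷ xs)) ⟩
  map (sum ∘ map (λ _ → 1)) (runs R (x ∷ xs))
    ≡⟨ sum-runs (λ _ → 1) R x xs (All.universal (λ _ → s≤s z≤n) (x ∷ xs)) ⟩
  bitsToComp (gapList (λ _ → 1) (λ _ → false) (λ y z → not (R y z)) (x ∷ xs))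
    ≡⟨ cong bitsToComp (unitGaps x xs) ⟩
  bitsToComp (adjacentBits (λ y z → not (R y z)) (x ∷ xs)) ∎
  where
  open ≡-Reasoning
  length≡sum-ones : ∀ (g : List _) → length g ≡ sum (map (λ _ → 1) g)
  length≡sum-ones [] = refl
  length≡sum-ones (_ ∷ g) = cong suc (length≡sum-ones g)
  unitGaps : ∀ x xs → gapList (λ _ → 1) (λ _ → false) (λ y z → not (R y z)) (x ∷ xs)
                      ≡ adjacentBits (λ y z → not (R y z)) (x ∷ xs)
  unitGaps x [] = refl
  unitGaps x (y ∷ xs) = cong (not (R x y) ∷_) (unitGaps y xs)

Nonzero : ℤ → Set
Nonzero a = 1 ≤ ∣ a ∣

nonzero : ∀ a → a ≢ + 0 → Nonzero a
nonzero (+ zero) a≢0 = contradiction refl a≢0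
nonzero (+ suc _) _ = s≤s z≤n
nonzero -[1+ _ ] _ = s≤s z≤n

isNeg : ℤ → Bool
isNeg a = not (posᵇ a)

record Gap : Set where
  constructor gap
  field
    cut : Bool
    left right : ℤ

open Gap

-- Position i of {1, …, n − 1} is the gap between the i-th and (i+1)-th entries of a window;
-- it is a cut when it separates two parts of α, and left/right are the parts on either side.
gaps : List ℤ → List Gap
gaps = gapList ∣_∣ (λ a → gap false a a) (gap true)

map-gaps : ∀ {B : Set} (f : Gap → B) α →
  map f (gaps α) ≡ gapList ∣_∣ (λ a → f (gap false a a)) (λ a b → f (gap true a b)) α
map-gaps f = map-gapList f ∣_∣ (λ a → gap false a a) (gap true)

underBits : List ℤ → List Bool
underBits = gapList ∣_∣ (λ _ → false) sameSignᵇ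

underBit : Gap → Bool
underBit g = cut g ∧ sameSignᵇ (left g) (right g)

OBit : Gap → Bool
OBit g = cut g ∨ isNeg (left g)

UBit : Gap → Bool
UBit g = not (cut g) ∧ isNeg (left g)

absC-gaps : ∀ a r → All Nonzero (a ∷ r) → absC (a ∷ r) ≡ bitsToComp (map cut (gaps (a ∷ r)))
absC-gaps a r nz = sym (trans (cong bitsToComp (map-gaps cut (a ∷ r))) (bitsToComp-parts ∣_∣ a r nz))

under-gaps : ∀ a r → All Nonzero (a ∷ r) →
  under (a ∷ r) ≡ bitsToComp (map underBit (gaps (a ∷ r)))
under-gaps a r nz = trans (sum-runs ∣_∣ (λ a b → not (sameSignᵇ a b)) a r nz) (cong bitsToComp (begin
  gapList ∣_∣ (λ _ → false) (λ a b → not (not (sameSignᵇ a b))) (a ∷ r)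
    ≡⟨ gapList-cong ∣_∣ (λ _ → false) (λ a b → not-involutive (sameSignᵇ a b)) (a ∷ r) ⟩
  underBits (a ∷ r)
    ≡⟨ sym (map-gaps underBit (a ∷ r)) ⟩
  map underBit (gaps (a ∷ r)) ∎))
  where open ≡-Reasoning

oPart : ℤ → List ℕ
oPart a = if posᵇ a then ∣ a ∣ ∷ [] else replicate ∣ a ∣ 1

oSegment : List ℤ → List ℕ
oSegment σ = if all posᵇ σ then map ∣_∣ σ else replicate (sum (map ∣_∣ σ)) 1

posᵇ-sameSign : ∀ a b → sameSignᵇ a b ≡ true → posᵇ a ≡ posᵇ b
posᵇ-sameSign a b eq with posᵇ a | posᵇ b
... | true | true = refl
... | false | false = refl

all-posᵇ-segment : ∀ b g → chain sameSignᵇ (b ∷ g) ≡ true → all posᵇ (b ∷ g) ≡ posᵇ b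
all-posᵇ-segment b [] _ = ∧-identityʳ (posᵇ b)
all-posᵇ-segment b (c ∷ g) ch with sameSignᵇ b c in bc
... | true rewrite all-posᵇ-segment c g ch | posᵇ-sameSign b c bc with posᵇ c
...   | true = refl
...   | false = refl

oSegment-∷ : ∀ a b g → sameSignᵇ a b ≡ true → chain sameSignᵇ (b ∷ g) ≡ true →
  oSegment (a ∷ b ∷ g) ≡ oPart a ++ oSegment (b ∷ g)
oSegment-∷ a b g ab ch with all posᵇ (b ∷ g) | all-posᵇ-segment b g ch
... | _ | refl rewrite sym (posᵇ-sameSign a b ab) with posᵇ a
...   | true = refl
...   | false = replicate-+ ∣ a ∣ _
  where
  replicate-+ : ∀ m n → replicate (m + n) 1 ≡ replicate m 1 ++ replicate n 1
  replicate-+ zero n = refl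
  replicate-+ (suc m) n = cong (1 ∷_) (replicate-+ m n)

oSegment-[-] : ∀ a → oSegment (a ∷ []) ≡ oPart a
oSegment-[-] a with posᵇ a
... | true = refl
... | false = cong (λ k → replicate k 1) (+-identityʳ ∣ a ∣)

O-∷∷ : ∀ a b r → O (a ∷ b ∷ r) ≡ oPart a ++ O (b ∷ r)
O-∷∷ a b r with runs sameSignᵇ (b ∷ r) | runs-head sameSignᵇ b r
... | _ | g , gs , refl , ch with sameSignᵇ a b in ab
...   | true = trans (cong (_++ List.concatMap oSegment gs) (oSegment-∷ a b g ab ch)) (++-assoc (oPart a) _ _)
...   | false = cong (_++ (oSegment (b ∷ g) ++ List.concatMap oSegment gs)) (oSegment-[-] a)

O-gaps : ∀ a r → All Nonzero (a ∷ r) → O (a ∷ r) ≡ bitsToComp (map OBit (gaps (a ∷ r)))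
O-gaps a r nz = trans (O-parts a r nz) (cong bitsToComp (sym (map-gaps OBit (a ∷ r))))
  where
  O-parts : ∀ a r → All Nonzero (a ∷ r) → O (a ∷ r) ≡ bitsToComp (gapList ∣_∣ isNeg (λ _ _ → true) (a ∷ r))
  O-parts (+ zero) r (() ∷ _)
  O-parts (+ suc k) [] _ = trans (++-identityʳ _) (sym (bitsToComp-falses k))
  O-parts -[1+ k ] [] _ = trans (++-identityʳ _) (trans (oSegment-[-] -[1+ k ]) (sym (bitsToComp-trues k)))
  O-parts (+ suc k) (b ∷ r) (_ ∷ nz) =
    trans (O-∷∷ (+ suc k) b r) (trans (cong (suc k ∷_) (O-parts b r nz)) (sym (bitsToComp-falses-true k _)))
  O-parts -[1+ k ] (b ∷ r) (_ ∷ nz) =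
    trans (O-∷∷ -[1+ k ] b r)
          (trans (cong (replicate (suc k) 1 ++_) (O-parts b r nz))
                 (sym (trans (bitsToComp-trues-++ k (true ∷ _)) (ones-snoc k))))
    where
    ones-snoc : ∀ k {B} → replicate k 1 ++ 1 ∷ B ≡ replicate (suc k) 1 ++ B
    ones-snoc zero = refl
    ones-snoc (suc k) = cong (1 ∷_) (ones-snoc k)

negate : ℕ → ℤ
negate b = ℤ.- (+ b)

uSegment : List ℤ → List ℤ
uSegment σ = if all posᵇ σ then (+ sum (map ∣_∣ σ)) ∷ [] else map (λ b → ℤ.- (+ b)) (compl (map ∣_∣ σ))

uBits : List ℤ → List Bool
uBits = gapList ∣_∣ isNeg (λ _ _ → false)

replicate-+-suc : ∀ {A : Set} m j (x : A) → replicate (m + suc j) x ≡ replicate m x ++ x ∷ replicate j x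
replicate-+-suc zero j x = refl
replicate-+-suc (suc m) j x = cong (x ∷_) (replicate-+-suc m j x)

replicate-suc-++ : ∀ {A : Set} k (x : A) L → replicate (suc k) x ++ L ≡ replicate k x ++ x ∷ L
replicate-suc-++ zero x L = refl
replicate-suc-++ (suc k) x L = cong (x ∷_) (replicate-suc-++ k x L)

underBits-widen : ∀ m x x′ L → ∣ x′ ∣ ∸ 1 ≡ m + suc (∣ x ∣ ∸ 1) → posᵇ x ≡ posᵇ x′ →
  underBits (x′ ∷ L) ≡ replicate m false ++ false ∷ underBits (x ∷ L)
underBits-widen m x x′ [] e _ rewrite e = replicate-+-suc m _ false
underBits-widen m x x′ (y ∷ L) e x~x′ rewrite e | x~x′ =
  trans (cong (_++ _) (replicate-+-suc m (∣ x ∣ ∸ 1) false)) (++-assoc (replicate m false) _ _)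

underBits-minusOnes : ∀ k x L → posᵇ x ≡ false →
  underBits (replicate k -1ℤ ++ x ∷ L) ≡ replicate k true ++ underBits (x ∷ L)
underBits-minusOnes zero x L _ = refl
underBits-minusOnes (suc zero) x L x<0 rewrite x<0 = refl
underBits-minusOnes (suc (suc k)) x L x<0 = cong (true ∷_) (underBits-minusOnes (suc k) x L x<0)

underBits-minusOnes-[] : ∀ k → underBits (replicate (suc k) -1ℤ) ≡ replicate k true
underBits-minusOnes-[] zero = refl
underBits-minusOnes-[] (suc k) = cong (true ∷_) (underBits-minusOnes-[] k)

uSegment-negative : ∀ k → uSegment (-[1+ k ] ∷ []) ≡ replicate (suc k) -1ℤ
uSegment-negative k = begin
  map negate (compl (suc k ∷ []))                     ≡⟨ cong (λ γ → map negate (compl γ)) (sym (bitsToComp-falses k)) ⟩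
  map negate (compl (bitsToComp (replicate k false))) ≡⟨ cong (map negate) (compl-bitsToComp (replicate k false)) ⟩
  map negate (bitsToComp (map not (replicate k false))) ≡⟨ cong (λ B → map negate (bitsToComp B)) (map-replicate not k false) ⟩
  map negate (bitsToComp (replicate k true))          ≡⟨ cong (map negate) (bitsToComp-trues k) ⟩
  map negate (replicate (suc k) 1)                    ≡⟨ map-replicate negate (suc k) 1 ⟩
  replicate (suc k) -1ℤ                               ∎
  where open ≡-Reasoning

HeadSign : Bool → List ℤ → Set
HeadSign c L = ∃₂ λ y ys → L ≡ y ∷ ys × posᵇ y ≡ c

-- U α is `under` of L = concatMap uSegment (segments α). Inducting along α we also track the sign
-- of L's first part, which decides whether `under` merges it with a new first part of α.
UInv : Bool → List Bool → List ℤ → Set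
UInv c B L = All Nonzero L × HeadSign c L × underBits L ≡ B

UInv-newPositive : ∀ k G L → UInv false G L → UInv true (replicate k false ++ false ∷ G) (+ (suc k + 0) ∷ L)
UInv-newPositive k G .(y ∷ ys) (nz , (y , ys , refl , y<0) , bits) rewrite +-identityʳ k | y<0 =
  s≤s z≤n ∷ nz , (_ , _ , refl , refl) , cong (λ B → replicate k false ++ false ∷ B) bits

UInv-newNegative : ∀ k G L → UInv true G L → UInv false (replicate k true ++ false ∷ G) (replicate (suc k) -1ℤ ++ L)
UInv-newNegative k G .(y ∷ ys) (nz , (y , ys , refl , y>0) , bits) =
  ++⁺ (replicate⁺ (suc k) (s≤s z≤n)) nz , (_ , _ , refl , refl) ,
  trans (cong underBits (replicate-suc-++ k -1ℤ (y ∷ ys)))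
        (trans (underBits-minusOnes k -1ℤ (y ∷ ys) refl) (cong (replicate k true ++_) (boundary y>0)))
  where
  boundary : posᵇ y ≡ true → underBits (-1ℤ ∷ y ∷ ys) ≡ false ∷ G
  boundary y>0 rewrite y>0 = cong (false ∷_) bits

UInv-extendPositive : ∀ k S L G → All Nonzero (+ suc S ∷ L) → underBits (+ suc S ∷ L) ≡ G →
  UInv true (replicate k false ++ false ∷ G) (+ (suc k + suc S) ∷ L)
UInv-extendPositive k S L G (_ ∷ nz) bits =
  s≤s z≤n ∷ nz , (_ , _ , refl , refl) ,
  trans (underBits-widen k (+ suc S) (+ (suc k + suc S)) L refl refl) (cong (λ B → replicate k false ++ false ∷ B) bits)

UInv-extendNegative : ∀ k h t L G → All Nonzero (-[1+ h ] ∷ map negate t ++ L) →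
  underBits (-[1+ h ] ∷ map negate t ++ L) ≡ G →
  UInv false (replicate k true ++ false ∷ G) ((replicate k -1ℤ ++ -[1+ suc h ] ∷ map negate t) ++ L)
UInv-extendNegative k h t L G (_ ∷ nz) bits rewrite ++-assoc (replicate k -1ℤ) (-[1+ suc h ] ∷ map negate t) L =
  ++⁺ (replicate⁺ k (s≤s z≤n)) (s≤s z≤n ∷ nz) , head k ,
  trans (underBits-minusOnes k _ _ refl)
        (cong (replicate k true ++_)
              (trans (underBits-widen 0 -[1+ h ] -[1+ suc h ] (map negate t ++ L) refl refl) (cong (false ∷_) bits)))
  where
  head : ∀ k → HeadSign false (replicate k -1ℤ ++ -[1+ suc h ] ∷ map negate t ++ L)
  head zero = _ , _ , refl , refl
  head (suc k) = _ , _ , refl , refl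

uSegments-UInv : ∀ a r → All Nonzero (a ∷ r) →
  UInv (posᵇ a) (uBits (a ∷ r)) (List.concatMap uSegment (segments (a ∷ r)))
uSegments-UInv (+ zero) r (() ∷ _)
uSegments-UInv (+ suc k) [] _ = s≤s z≤n ∷ [] , (_ , [] , refl , refl) , cong (λ j → replicate j false) (+-identityʳ k)
uSegments-UInv -[1+ k ] [] _ rewrite ++-identityʳ (uSegment (-[1+ k ] ∷ [])) | uSegment-negative k =
  replicate⁺ (suc k) (s≤s z≤n) , (_ , _ , refl , refl) , underBits-minusOnes-[] k
uSegments-UInv (+ suc k) (+ zero ∷ r) (_ ∷ () ∷ _)
uSegments-UInv -[1+ k ] (+ zero ∷ r) (_ ∷ () ∷ _)
uSegments-UInv (+ suc k) (+ suc j ∷ r) (_ ∷ nz)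
  with runs sameSignᵇ (+ suc j ∷ r) | runs-head sameSignᵇ (+ suc j) r | uSegments-UInv (+ suc j) r nz
... | _ | g , gs , refl , ch | (nz′ , _ , bits) rewrite all-posᵇ-segment (+ suc j) g ch =
  UInv-extendPositive k (j + sum (map ∣_∣ g)) (List.concatMap uSegment gs) _ nz′ bits
uSegments-UInv (+ suc k) (-[1+ j ] ∷ r) (_ ∷ nz)
  with runs sameSignᵇ (-[1+ j ] ∷ r) | runs-head sameSignᵇ -[1+ j ] r | uSegments-UInv -[1+ j ] r nz
... | _ | g , gs , refl , _ | inv = UInv-newPositive k _ _ inv
uSegments-UInv -[1+ k ] (+ suc j ∷ r) (_ ∷ nz)
  with runs sameSignᵇ (+ suc j ∷ r) | runs-head sameSignᵇ (+ suc j) r | uSegments-UInv (+ suc j) r nz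
... | _ | g , gs , refl , _ | inv rewrite uSegment-negative k = UInv-newNegative k _ _ inv
uSegments-UInv -[1+ k ] (-[1+ j ] ∷ r) (_ ∷ nz)
  with runs sameSignᵇ (-[1+ j ] ∷ r) | runs-head sameSignᵇ -[1+ j ] r
     | runs-concat sameSignᵇ (-[1+ j ] ∷ r) | uSegments-UInv -[1+ j ] r nz
... | _ | g , gs , refl , ch | split | inv
  with compl (suc j ∷ map ∣_∣ g) | compl-head (suc j ∷ map ∣_∣ g) γ-comp | compl-∷ k (suc j ∷ map ∣_∣ g) γ-comp
  where
  γ-comp : IsComp (suc (j + sum (map ∣_∣ g))) (suc j ∷ map ∣_∣ g)
  γ-comp = map⁺ (++⁻ˡ (-[1+ j ] ∷ g) (subst (All Nonzero) (sym split) nz)) , refl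
... | _ | h , t , refl | γ-step rewrite all-posᵇ-segment -[1+ j ] g ch | γ-step
                                      | map-++ negate (replicate k 1) (suc (suc h) ∷ t) | map-replicate negate k 1 =
  UInv-extendNegative k h t (List.concatMap uSegment gs) _ (proj₁ inv) (proj₂ (proj₂ inv))

U-gaps : ∀ a r → All Nonzero (a ∷ r) → U (a ∷ r) ≡ bitsToComp (map UBit (gaps (a ∷ r)))
U-gaps a r nz with List.concatMap uSegment (segments (a ∷ r)) | uSegments-UInv a r nz
... | .(y ∷ ys) | nz′ , (y , ys , refl , _) , bits =
  trans (sum-runs ∣_∣ (λ a b → not (sameSignᵇ a b)) y ys nz′)
        (cong bitsToComp (trans (gapList-cong ∣_∣ (λ _ → false) (λ a b → not-involutive (sameSignᵇ a b)) (y ∷ ys))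
                                (trans bits (sym (map-gaps UBit (a ∷ r))))))

allGapsᵇ : {G A : Set} → (G → A → A → Bool) → List G → List A → Bool
allGapsᵇ H (g ∷ gs) (x ∷ y ∷ z) = H g x y ∧ allGapsᵇ H gs (y ∷ z)
allGapsᵇ H _ _ = true

AllGaps : {G A : Set} → (G → A → A → Set) → List G → List A → Set
AllGaps P (g ∷ gs) (x ∷ y ∷ z) = P g x y × AllGaps P gs (y ∷ z)
AllGaps P _ _ = ⊤

allGapsᵇ-[] : ∀ {G A : Set} (H : G → A → A → Bool) gs → allGapsᵇ H gs [] ≡ true
allGapsᵇ-[] H [] = refl
allGapsᵇ-[] H (g ∷ gs) = refl

allGapsᵇ-drop : ∀ {G A : Set} (H : G → A → A → Bool) g gs j (z : List A) → (∀ x y → H g x y ≡ true) →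
  allGapsᵇ H (g ∷ gs) (drop j z) ≡ allGapsᵇ H gs (drop (suc j) z)
allGapsᵇ-drop H g gs zero [] _ = sym (allGapsᵇ-[] H gs)
allGapsᵇ-drop H g gs zero (x ∷ []) _ = sym (allGapsᵇ-[] H gs)
allGapsᵇ-drop H g gs zero (x ∷ y ∷ z) Hg = cong (_∧ allGapsᵇ H gs (y ∷ z)) (Hg x y)
allGapsᵇ-drop H g gs (suc j) [] _ = sym (allGapsᵇ-[] H gs)
allGapsᵇ-drop H g gs (suc j) (x ∷ z) Hg = allGapsᵇ-drop H g gs j z Hg

allGapsᵇ-replicate : ∀ {G A : Set} (H : G → A → A → Bool) (R : A → A → Bool) g j gs (z : List A) →
  (∀ x y → H g x y ≡ R x y) →
  allGapsᵇ H (replicate j g ++ gs) z ≡ chain R (take (suc j) z) ∧ allGapsᵇ H gs (drop j z)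
allGapsᵇ-replicate H R g zero gs [] _ = refl
allGapsᵇ-replicate H R g zero gs (x ∷ z) _ = refl
allGapsᵇ-replicate H R g (suc j) gs [] _ = sym (allGapsᵇ-[] H gs)
allGapsᵇ-replicate H R g (suc j) gs (x ∷ []) _ = sym (trans (cong (allGapsᵇ H gs) (drop-[] j)) (allGapsᵇ-[] H gs))
allGapsᵇ-replicate H R g (suc j) gs (x ∷ y ∷ z) HR
  rewrite HR x y | allGapsᵇ-replicate H R g j gs (y ∷ z) HR = sym (∧-assoc (R x y) _ _)

allGapsᵇ-∧ : ∀ {G A : Set} (F H : G → A → A → Bool) gs (z : List A) →
  allGapsᵇ F gs z ∧ allGapsᵇ H gs z ≡ allGapsᵇ (λ g x y → F g x y ∧ H g x y) gs z
allGapsᵇ-∧ F H [] z = refl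
allGapsᵇ-∧ F H (g ∷ gs) [] = refl
allGapsᵇ-∧ F H (g ∷ gs) (x ∷ []) = refl
allGapsᵇ-∧ F H (g ∷ gs) (x ∷ y ∷ z) =
  trans (∧ₚ.interchange (F g x y) _ (H g x y) _) (cong ((F g x y ∧ H g x y) ∧_) (allGapsᵇ-∧ F H gs (y ∷ z)))

allGapsᵇ-cong : ∀ {G A : Set} {P : G → A → A → Set} (F H : G → A → A → Bool) gs (z : List A) →
  (∀ {g x y} → P g x y → F g x y ≡ H g x y) → AllGaps P gs z → allGapsᵇ F gs z ≡ allGapsᵇ H gs z
allGapsᵇ-cong F H [] z F≗H _ = refl
allGapsᵇ-cong F H (g ∷ gs) [] F≗H _ = refl
allGapsᵇ-cong F H (g ∷ gs) (x ∷ []) F≗H _ = refl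
allGapsᵇ-cong F H (g ∷ gs) (x ∷ y ∷ z) F≗H (p , ps) = cong₂ _∧_ (F≗H p) (allGapsᵇ-cong F H gs (y ∷ z) F≗H ps)

adjacentBits-⊆ᵇ : ∀ {G A : Set} (D : A → A → Bool) (f : G → Bool) gs z →
  adjacentBits D z ⊆ᵇ map f gs ≡ allGapsᵇ (λ g x y → not (D x y) ∨ f g) gs z
adjacentBits-⊆ᵇ D f [] [] = refl
adjacentBits-⊆ᵇ D f [] (x ∷ []) = refl
adjacentBits-⊆ᵇ D f [] (x ∷ y ∷ z) = refl
adjacentBits-⊆ᵇ D f (g ∷ gs) [] = refl
adjacentBits-⊆ᵇ D f (g ∷ gs) (x ∷ []) = refl
adjacentBits-⊆ᵇ D f (g ∷ gs) (x ∷ y ∷ z) = cong ((not (D x y) ∨ f g) ∧_) (adjacentBits-⊆ᵇ D f gs (y ∷ z))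

⊆ᵇ-adjacentBits : ∀ {G A : Set} (D : A → A → Bool) (f : G → Bool) gs z →
  map f gs ⊆ᵇ adjacentBits D z ≡ allGapsᵇ (λ g x y → not (f g) ∨ D x y) gs z
⊆ᵇ-adjacentBits D f [] z = refl
⊆ᵇ-adjacentBits D f (g ∷ gs) [] = refl
⊆ᵇ-adjacentBits D f (g ∷ gs) (x ∷ []) = refl
⊆ᵇ-adjacentBits D f (g ∷ gs) (x ∷ y ∷ z) = cong ((not (f g) ∨ D x y) ∧_) (⊆ᵇ-adjacentBits D f gs (y ∷ z))

signsMatch : List ℤ → List ℤ → Bool
signsMatch [] z = true
signsMatch (a ∷ α) z = all (sameSignᵇ a) (take ∣ a ∣ z) ∧ signsMatch α (drop ∣ a ∣ z)

blockCond-gaps : ∀ (R : ℤ → ℤ → Bool) a r z → All Nonzero (a ∷ r) →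
  blockCond R (a ∷ r) z ≡ allGapsᵇ (λ g x y → cut g ∨ R x y) (gaps (a ∷ r)) z ∧ signsMatch (a ∷ r) z
blockCond-gaps R a [] z (p ∷ []) with ∣ a ∣ | p
... | suc k | _ = begin
  (chain R (take (suc k) z) ∧ all (sameSignᵇ a) (take (suc k) z)) ∧ true
    ≡⟨ ∧ₚ.interchange (chain R (take (suc k) z)) _ true true ⟩
  (chain R (take (suc k) z) ∧ true) ∧ (all (sameSignᵇ a) (take (suc k) z) ∧ true)
    ≡⟨ cong (_∧ _) (sym (trans (cong (λ gs → allGapsᵇ H gs z) (sym (++-identityʳ (replicate k (gap false a a)))))
                                (allGapsᵇ-replicate H R (gap false a a) k [] z λ _ _ → refl))) ⟩
  allGapsᵇ H (replicate k (gap false a a)) z ∧ (all (sameSignᵇ a) (take (suc k) z) ∧ true) ∎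
  where
  open ≡-Reasoning
  H : Gap → ℤ → ℤ → Bool
  H g x y = cut g ∨ R x y
blockCond-gaps R a (b ∷ r) z (p ∷ ps) with ∣ a ∣ | p
... | suc k | _
  rewrite allGapsᵇ-replicate (λ g x y → cut g ∨ R x y) R (gap false a a) k (gap true a b ∷ gaps (b ∷ r)) z (λ _ _ → refl)
        | allGapsᵇ-drop (λ g x y → cut g ∨ R x y) (gap true a b) (gaps (b ∷ r)) k z (λ _ _ → refl)
        | blockCond-gaps R b r (drop (suc k) z) ps =
  ∧ₚ.interchange (chain R (take (suc k) z)) (all (sameSignᵇ a) (take (suc k) z)) _ _

signPattern : List ℤ → List Sign
signPattern = List.concatMap (λ a → replicate ∣ a ∣ (sign a))

length-signPattern : ∀ α → length (signPattern α) ≡ sum (absC α)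
length-signPattern [] = refl
length-signPattern (a ∷ α) =
  trans (length-++ (replicate ∣ a ∣ (sign a))) (cong₂ _+_ (length-replicate ∣ a ∣) (length-signPattern α))

sign-sameSign : ∀ a x → Nonzero a → Nonzero x → sameSignᵇ a x ≡ true → sign x ≡ sign a
sign-sameSign (+ suc _) (+ suc _) _ _ _ = refl
sign-sameSign -[1+ _ ] -[1+ _ ] _ _ _ = refl
sign-sameSign (+ suc _) -[1+ _ ] _ _ ()
sign-sameSign -[1+ _ ] (+ suc _) _ _ ()

map-sign-sameSigns : ∀ a xs → Nonzero a → All Nonzero xs → all (sameSignᵇ a) xs ≡ true →
  map sign xs ≡ replicate (length xs) (sign a)
map-sign-sameSigns a [] _ _ _ = refl
map-sign-sameSigns a (x ∷ xs) a≢0 (x≢0 ∷ nz) same =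
  cong₂ _∷_ (sign-sameSign a x a≢0 x≢0 (∧-conicalˡ _ _ same))
            (map-sign-sameSigns a xs a≢0 nz (∧-conicalʳ _ _ same))

signsMatch⇒signPattern : ∀ α z → All Nonzero α → All Nonzero z → length z ≡ sum (absC α) →
  signsMatch α z ≡ true → map sign z ≡ signPattern α
signsMatch⇒signPattern [] [] _ _ _ _ = refl
signsMatch⇒signPattern (a ∷ α) z (a≢0 ∷ nzα) nz len match = begin
  map sign z                                        ≡⟨ cong (map sign) (sym (take++drop≡id k z)) ⟩
  map sign (take k z ++ drop k z)                   ≡⟨ map-++ sign (take k z) (drop k z) ⟩
  map sign (take k z) ++ map sign (drop k z)        ≡⟨ cong₂ _++_ head tail ⟩
  replicate k (sign a) ++ signPattern α             ∎
  where
  open ≡-Reasoning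
  k = ∣ a ∣
  head : map sign (take k z) ≡ replicate k (sign a)
  head = trans (map-sign-sameSigns a (take k z) a≢0 (take⁺ k nz) (∧-conicalˡ _ _ match))
               (cong (λ j → replicate j (sign a)) (trans (length-take k z) (m≤n⇒m⊓n≡m (subst (k ≤_) (sym len) (m≤m+n k _)))))
  tail : map sign (drop k z) ≡ signPattern α
  tail = signsMatch⇒signPattern α (drop k z) nzα (drop⁺ k nz)
           (trans (length-drop k z) (trans (cong (_∸ k) len) (m+n∸m≡n k _))) (∧-conicalʳ _ _ match)

all-sameSign : ∀ a xs j → Nonzero a → All Nonzero xs → map sign xs ≡ replicate j (sign a) →
  all (sameSignᵇ a) xs ≡ true
all-sameSign a [] j _ _ _ = refl
all-sameSign a (x ∷ xs) (suc j) a≢0 (x≢0 ∷ nz) signs =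
  cong₂ _∧_ (sameSign a x a≢0 x≢0 (proj₁ (∷-injective signs))) (all-sameSign a xs j a≢0 nz (proj₂ (∷-injective signs)))
  where
  sameSign : ∀ a x → Nonzero a → Nonzero x → sign x ≡ sign a → sameSignᵇ a x ≡ true
  sameSign (+ suc _) (+ suc _) _ _ _ = refl
  sameSign -[1+ _ ] -[1+ _ ] _ _ _ = refl

signPattern⇒signsMatch : ∀ α z → All Nonzero α → All Nonzero z → map sign z ≡ signPattern α →
  signsMatch α z ≡ true
signPattern⇒signsMatch [] z _ _ _ = refl
signPattern⇒signsMatch (a ∷ α) z (a≢0 ∷ nzα) nz signs = cong₂ _∧_
  (all-sameSign a (take k z) k a≢0 (take⁺ k nz)
    (trans (sym (take-map k z)) (trans (cong (take k) signs) (take-replicate-++ k (signPattern α)))))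
  (signPattern⇒signsMatch α (drop k z) nzα (drop⁺ k nz)
    (trans (sym (drop-map k z)) (trans (cong (drop k) signs) (drop-replicate-++ k (signPattern α)))))
  where
  k = ∣ a ∣
  take-replicate-++ : ∀ j L → take j (replicate j (sign a) ++ L) ≡ replicate j (sign a)
  take-replicate-++ zero L = refl
  take-replicate-++ (suc j) L = cong (sign a ∷_) (take-replicate-++ j L)
  drop-replicate-++ : ∀ j L → drop j (replicate j (sign a) ++ L) ≡ L
  drop-replicate-++ zero L = refl
  drop-replicate-++ (suc j) L = drop-replicate-++ j L

ValidGap : Gap → Set
ValidGap (gap c a b) = Nonzero a × Nonzero b × (c ≡ false → a ≡ b)

data Fits : Gap → ℤ → ℤ → Set where
  fits : ∀ {c a b p q} → ValidGap (gap c a b) → p ≢ q → Fits (gap c a b) (sign a ◃ suc p) (sign b ◃ suc q)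

valid-gaps : ∀ α → All Nonzero α → All ValidGap (gaps α)
valid-gaps [] _ = []
valid-gaps (a ∷ []) (a≢0 ∷ []) = replicate⁺ _ (a≢0 , a≢0 , λ _ → refl)
valid-gaps (a ∷ b ∷ r) (a≢0 ∷ b≢0 ∷ nz) =
  ++⁺ (replicate⁺ _ (a≢0 , a≢0 , λ _ → refl)) ((a≢0 , b≢0 , λ ()) ∷ valid-gaps (b ∷ r) (b≢0 ∷ nz))

pairs : {A : Set} → List A → List (A × A)
pairs (x ∷ y ∷ r) = (x , y) ∷ pairs (y ∷ r)
pairs _ = []

gapSigns : Gap → Sign × Sign
gapSigns g = sign (left g) , sign (right g)

pairs-signPattern : ∀ α → All Nonzero α → pairs (signPattern α) ≡ map gapSigns (gaps α)
pairs-signPattern α nz = trans (pairs-blocks α nz) (sym (map-gaps gapSigns α))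
  where
  pairs-replicate-++ : ∀ k σ τ L →
    pairs (replicate (suc k) σ ++ τ ∷ L) ≡ replicate k (σ , σ) ++ (σ , τ) ∷ pairs (τ ∷ L)
  pairs-replicate-++ zero σ τ L = refl
  pairs-replicate-++ (suc k) σ τ L = cong ((σ , σ) ∷_) (pairs-replicate-++ k σ τ L)
  pairs-replicate : ∀ k σ → pairs (replicate (suc k) σ) ≡ replicate k (σ , σ)
  pairs-replicate zero σ = refl
  pairs-replicate (suc k) σ = cong ((σ , σ) ∷_) (pairs-replicate k σ)
  pairs-blocks : ∀ α → All Nonzero α →
    pairs (signPattern α) ≡ gapList ∣_∣ (λ a → sign a , sign a) (λ a b → sign a , sign b) α
  pairs-blocks [] _ = refl
  pairs-blocks (a ∷ []) (a≢0 ∷ []) with ∣ a ∣ | a≢0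
  ... | suc k | _ = trans (cong pairs (++-identityʳ (replicate (suc k) (sign a)))) (pairs-replicate k (sign a))
  pairs-blocks (a ∷ b ∷ r) (a≢0 ∷ b≢0 ∷ nz) with ∣ a ∣ | a≢0 | ∣ b ∣ | b≢0 | pairs-blocks (b ∷ r) (b≢0 ∷ nz)
  ... | suc k | _ | suc j | _ | ih =
    trans (pairs-replicate-++ k (sign a) (sign b) _) (cong (λ t → replicate k (sign a , sign a) ++ (sign a , sign b) ∷ t) ih)

AllGaps-Fits : ∀ gs s v → pairs s ≡ map gapSigns gs → All ValidGap gs → Linked _≢_ v →
  AllGaps Fits gs (zipWith _◃_ s (map suc v))
AllGaps-Fits [] s v _ _ _ = tt
AllGaps-Fits (g ∷ gs) (σ ∷ τ ∷ s) [] _ _ _ = tt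
AllGaps-Fits (g ∷ gs) (σ ∷ τ ∷ s) (p ∷ []) _ _ _ = tt
AllGaps-Fits (gap c a b ∷ gs) (σ ∷ τ ∷ s) (p ∷ q ∷ v) signs (valid ∷ valids) (p≢q ∷ linked)
  with ∷-injective signs
... | refl , signs′ = fits valid p≢q , AllGaps-Fits gs (sign b ∷ s) (q ∷ v) signs′ valids linked

map-sign-window : ∀ s v → length s ≡ length v → map sign (zipWith _◃_ s (map suc v)) ≡ s
map-sign-window [] [] _ = refl
map-sign-window (σ ∷ s) (p ∷ v) eq = cong₂ _∷_ (sign-◃ σ (suc p)) (map-sign-window s v (suc-injective eq))

map-abs-window : ∀ s v → length s ≡ length v → map ∣_∣ (zipWith _◃_ s (map suc v)) ≡ map suc v
map-abs-window [] [] _ = refl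
map-abs-window (σ ∷ s) (p ∷ v) eq = cong₂ _∷_ (abs-◃ σ (suc p)) (map-abs-window s v (suc-injective eq))

window-nonzero : ∀ s v → All Nonzero (zipWith _◃_ s (map suc v))
window-nonzero [] v = []
window-nonzero (σ ∷ s) [] = []
window-nonzero (σ ∷ s) (p ∷ v) = subst (1 ≤_) (sym (abs-◃ σ (suc p))) (s≤s z≤n) ∷ window-nonzero s v

<ᵇ-flip : ∀ {p q} → p ≢ q → (q <ᵇ p) ≡ not (p <ᵇ q)
<ᵇ-flip {zero} {zero} p≢q = contradiction refl p≢q
<ᵇ-flip {zero} {suc q} _ = refl
<ᵇ-flip {suc p} {zero} _ = refl
<ᵇ-flip {suc p} {suc q} p≢q = <ᵇ-flip (p≢q ∘ cong suc)

<ᵇ-suc : ∀ {p q} → p ≢ q → (p <ᵇ suc q) ≡ (p <ᵇ q)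
<ᵇ-suc {zero} {zero} p≢q = contradiction refl p≢q
<ᵇ-suc {zero} {suc q} _ = refl
<ᵇ-suc {suc p} {zero} _ = refl
<ᵇ-suc {suc p} {suc q} p≢q = <ᵇ-suc (p≢q ∘ cong suc)

≤ᵇ-<ᵇ : ∀ {p q} → p ≢ q → (p ℕ.≤ᵇ q) ≡ (p <ᵇ q)
≤ᵇ-<ᵇ {zero} {zero} p≢q = contradiction refl p≢q
≤ᵇ-<ᵇ {zero} {suc q} _ = refl
≤ᵇ-<ᵇ {suc p} {zero} _ = refl
≤ᵇ-<ᵇ {suc p} {suc q} p≢q = <ᵇ-suc (p≢q ∘ cong suc)

sameSignᵇ-◃ : ∀ {a b} p q → Nonzero a → Nonzero b → sameSignᵇ (sign a ◃ suc p) (sign b ◃ suc q) ≡ sameSignᵇ a b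
sameSignᵇ-◃ {+ suc _} {+ suc _} p q _ _ = refl
sameSignᵇ-◃ {+ suc _} { -[1+ _ ]} p q _ _ = refl
sameSignᵇ-◃ { -[1+ _ ]} {+ suc _} p q _ _ = refl
sameSignᵇ-◃ { -[1+ _ ]} { -[1+ _ ]} p q _ _ = refl

sameSignᵇ-refl : ∀ a → sameSignᵇ a a ≡ true
sameSignᵇ-refl a with posᵇ a
... | true = refl
... | false = refl

descentᵇ : ℤ → ℤ → Bool
descentᵇ x y = ∣ y ∣ <ᵇ ∣ x ∣

gap-S : ∀ {g x y} → Fits g x y → (cut g ∨ (∣ x ∣ <ᵇ ∣ y ∣)) ≡ (not (descentᵇ x y) ∨ cut g)
gap-S (fits {c} {a} {b} {p} {q} _ p≢q) rewrite abs-◃ (sign a) (suc p) | abs-◃ (sign b) (suc q) | <ᵇ-flip p≢q =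
  trans (∨-comm c (p <ᵇ q)) (cong (_∨ c) (sym (not-involutive (p <ᵇ q))))

gap-T : ∀ {g x y} → Fits g x y →
  ((cut g ∨ (∣ x ∣ <ᵇ ∣ y ∣)) ∧ ((not (not (stepᵇ x y)) ∨ cut g) ∧ (not (cut g) ∨ not (stepᵇ x y))))
  ≡ ((not (underBit g) ∨ descentᵇ x y) ∧ (not (descentᵇ x y) ∨ cut g))
gap-T (fits {c} {a} {b} {p} {q} (a≢0 , b≢0 , interior) p≢q)
  rewrite abs-◃ (sign a) (suc p) | abs-◃ (sign b) (suc q) | <ᵇ-flip p≢q =
  boolean c (sameSignᵇ (sign a ◃ suc p) (sign b ◃ suc q)) (p <ᵇ q) (sameSignᵇ-◃ {a} {b} p q a≢0 b≢0)
          (λ c≡false → trans (cong (sameSignᵇ a) (sym (interior c≡false))) (sameSignᵇ-refl a))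
  where
  boolean : ∀ c s P → s ≡ sameSignᵇ a b → (c ≡ false → sameSignᵇ a b ≡ true) →
    ((c ∨ P) ∧ ((not (not (s ∧ P)) ∨ c) ∧ (not c ∨ not (s ∧ P))))
    ≡ ((not (c ∧ sameSignᵇ a b) ∨ not P) ∧ (not (not P) ∨ c))
  boolean c s P refl interior′ with sameSignᵇ a b | c | P
  ... | true | true | true = refl
  ... | true | true | false = refl
  ... | true | false | true = refl
  ... | true | false | false = refl
  ... | false | true | true = refl
  ... | false | true | false = refl
  ... | false | false | _ = contradiction (interior′ refl) λ ()

gap-St : ∀ {g x y} → Fits g x y →
  (cut g ∨ ltℤ x y) ≡ ((not (UBit g) ∨ descentᵇ x y) ∧ (not (descentᵇ x y) ∨ OBit g))
gap-St (fits {true} {a} {b} {p} {q} _ _) = sym (∨-zeroʳ (not (descentᵇ (sign a ◃ suc p) (sign b ◃ suc q))))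
gap-St (fits {false} {a} {b} {p} {q} (_ , _ , interior) p≢q) with interior refl
gap-St (fits {false} {+ suc _} {p = p} {q} _ p≢q) | refl =
  trans (cong not (<ᵇ-suc (p≢q ∘ sym))) (sym (∨-identityʳ (not (q <ᵇ p))))
gap-St (fits {false} { -[1+ _ ]} {p = p} {q} _ p≢q) | refl =
  trans (cong not (≤ᵇ-<ᵇ p≢q)) (trans (sym (<ᵇ-flip p≢q))
        (sym (trans (cong ((q <ᵇ p) ∧_) (∨-zeroʳ (not (q <ᵇ p)))) (∧-identityʳ (q <ᵇ p)))))

sumℚ-cong : ∀ {A : Set} (f g : A → ℚ) xs → (∀ x → f x ≡ g x) → sumℚ (map f xs) ≡ sumℚ (map g xs)
sumℚ-cong f g [] f≗g = refl
sumℚ-cong f g (x ∷ xs) f≗g = cong₂ ℚ._+_ (f≗g x) (sumℚ-cong f g xs f≗g)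

sumℚ-congᴬ : ∀ {A : Set} {P : A → Set} (f g : A → ℚ) xs → All P xs → (∀ {x} → P x → f x ≡ g x) →
  sumℚ (map f xs) ≡ sumℚ (map g xs)
sumℚ-congᴬ f g [] [] f≗g = refl
sumℚ-congᴬ f g (x ∷ xs) (px ∷ pxs) f≗g = cong₂ ℚ._+_ (f≗g px) (sumℚ-congᴬ f g xs pxs f≗g)

sumℚ-++ : ∀ {A : Set} (f : A → ℚ) xs ys → sumℚ (map f (xs ++ ys)) ≡ sumℚ (map f xs) ℚ.+ sumℚ (map f ys)
sumℚ-++ f [] ys = sym (ℚₚ.+-identityˡ _)
sumℚ-++ f (x ∷ xs) ys = trans (cong (f x ℚ.+_) (sumℚ-++ f xs ys)) (sym (ℚₚ.+-assoc (f x) _ _))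

sumℚ-concatMap : ∀ {A B : Set} (f : B → ℚ) (h : A → List B) xs →
  sumℚ (map f (List.concatMap h xs)) ≡ sumℚ (map (λ x → sumℚ (map f (h x))) xs)
sumℚ-concatMap f h [] = refl
sumℚ-concatMap f h (x ∷ xs) = trans (sumℚ-++ f (h x) _) (cong (sumℚ (map f (h x)) ℚ.+_) (sumℚ-concatMap f h xs))

sumℚ-zero : ∀ {A : Set} (xs : List A) → sumℚ (map (λ _ → 0ℚ) xs) ≡ 0ℚ
sumℚ-zero [] = refl
sumℚ-zero (x ∷ xs) = trans (cong (0ℚ ℚ.+_) (sumℚ-zero xs)) (ℚₚ.+-identityʳ 0ℚ)

sumℚ-+ : ∀ {A : Set} (f g : A → ℚ) xs → sumℚ (map (λ x → f x ℚ.+ g x) xs) ≡ sumℚ (map f xs) ℚ.+ sumℚ (map g xs)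
sumℚ-+ f g [] = sym (ℚₚ.+-identityʳ 0ℚ)
sumℚ-+ f g (x ∷ xs) = trans (cong (f x ℚ.+ g x ℚ.+_) (sumℚ-+ f g xs)) (+ₚ.interchange (f x) (g x) _ _)

sumℚ-swap : ∀ {A B : Set} (f : A → B → ℚ) xs ys →
  sumℚ (map (λ x → sumℚ (map (f x) ys)) xs) ≡ sumℚ (map (λ y → sumℚ (map (λ x → f x y) xs)) ys)
sumℚ-swap f [] ys = sym (sumℚ-zero ys)
sumℚ-swap f (x ∷ xs) ys = trans (cong (sumℚ (map (f x) ys) ℚ.+_) (sumℚ-swap f xs ys)) (sym (sumℚ-+ (f x) _ ys))

sumℚ-*ˡ : ∀ {A : Set} q (f : A → ℚ) xs → sumℚ (map (λ x → q ℚ.* f x) xs) ≡ q ℚ.* sumℚ (map f xs)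
sumℚ-*ˡ q f [] = sym (ℚₚ.*-zeroʳ q)
sumℚ-*ˡ q f (x ∷ xs) = trans (cong (q ℚ.* f x ℚ.+_) (sumℚ-*ˡ q f xs)) (sym (ℚₚ.*-distribˡ-+ q (f x) _))

-- allSigns n with sign vectors as lists instead of functions, so that distinct vectors are provably distinct
signLists : ℕ → List (List Sign)
signLists zero = [] ∷ []
signLists (suc n) = List.concatMap (λ s → (Sign.+ ∷ s) ∷ (Sign.- ∷ s) ∷ []) (signLists n)

sum-allSigns : ∀ n (H : List ℤ → ℚ) (g : Fin n → ℕ) →
  sumℚ (map (λ ε → H (List.tabulate (λ j → ε j ◃ g j))) (allSigns n))
  ≡ sumℚ (map (λ s → H (zipWith _◃_ s (List.tabulate g))) (signLists n))
sum-allSigns zero H g = refl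
sum-allSigns (suc n) H g =
  trans (sumℚ-concatMap (λ ε → H (List.tabulate (λ j → ε j ◃ g j))) (λ f → (Sign.+ ∷ᶠ f) ∷ (Sign.- ∷ᶠ f) ∷ []) (allSigns n))
  (trans (sum-allSigns n H′ (g ∘ Fin.suc))
         (sym (sumℚ-concatMap (λ s → H (zipWith _◃_ s (List.tabulate g))) (λ s → (Sign.+ ∷ s) ∷ (Sign.- ∷ s) ∷ [])
                              (signLists n))))
  where
  H′ : List ℤ → ℚ
  H′ w = H ((Sign.+ ◃ g Fin.zero) ∷ w) ℚ.+ (H ((Sign.- ◃ g Fin.zero) ∷ w) ℚ.+ 0ℚ)

sum-signLists-single : ∀ n (F : List Sign → ℚ) t → length t ≡ n →
  (∀ s → length s ≡ n → s ≢ t → F s ≡ 0ℚ) → sumℚ (map F (signLists n)) ≡ F t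
sum-signLists-single zero F [] _ F≡0 = ℚₚ.+-identityʳ (F [])
sum-signLists-single (suc n) F (σ ∷ t) len F≡0 =
  trans (sumℚ-concatMap F (λ s → (Sign.+ ∷ s) ∷ (Sign.- ∷ s) ∷ []) (signLists n))
        (trans (sum-signLists-single n G t (suc-injective len) G≡0) (G-at σ F≡0))
  where
  G : List Sign → ℚ
  G s = F (Sign.+ ∷ s) ℚ.+ (F (Sign.- ∷ s) ℚ.+ 0ℚ)
  G≡0 : ∀ s → length s ≡ n → s ≢ t → G s ≡ 0ℚ
  G≡0 s len′ s≢t
    rewrite F≡0 (Sign.+ ∷ s) (cong suc len′) (s≢t ∘ proj₂ ∘ ∷-injective)
          | F≡0 (Sign.- ∷ s) (cong suc len′) (s≢t ∘ proj₂ ∘ ∷-injective) = refl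
  G-at : ∀ σ → (∀ s → length s ≡ suc n → s ≢ σ ∷ t → F s ≡ 0ℚ) → G t ≡ F (σ ∷ t)
  G-at Sign.+ F≡0 rewrite F≡0 (Sign.- ∷ t) len (λ ()) =
    trans (cong (F (Sign.+ ∷ t) ℚ.+_) (ℚₚ.+-identityʳ 0ℚ)) (ℚₚ.+-identityʳ _)
  G-at Sign.- F≡0 rewrite F≡0 (Sign.+ ∷ t) len (λ ()) = trans (ℚₚ.+-identityˡ _) (ℚₚ.+-identityʳ _)

φ-forcedSigns : ∀ {n} (B : List ℤ → Bool) (u : Permutation′ n) t → length t ≡ n →
  (∀ s → length s ≡ n → B (zipWith _◃_ s (wordOf u)) ≡ true → s ≡ t) →
  φ (λ w → indicator (B (swordOf w))) u ≡ indicator (B (zipWith _◃_ t (wordOf u)))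
φ-forcedSigns {n} B u t len forced =
  trans (sum-allSigns n (indicator ∘ B) (λ j → suc (toℕ (u ⟨$⟩ʳ j))))
        (sum-signLists-single n (λ s → indicator (B (zipWith _◃_ s (wordOf u)))) t len vanish)
  where
  vanish : ∀ s → length s ≡ n → s ≢ t → indicator (B (zipWith _◃_ s (wordOf u))) ≡ 0ℚ
  vanish s len′ s≢t with B (zipWith _◃_ s (wordOf u)) in Bs
  ... | true = contradiction (forced s len′ Bs) s≢t
  ... | false = refl

-- Each composition of n + 1 is listed in comps (n + 1) exactly once, as a successor of predComp of it.
predComp : List ℕ → List ℕ
predComp [] = []
predComp (suc (suc b) ∷ r) = suc b ∷ r
predComp (_ ∷ r) = r

predComp-IsComp : ∀ {m} β → IsComp (suc m) β → IsComp m (predComp β)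
predComp-IsComp (suc zero ∷ r) (_ ∷ ps , s) = ps , suc-injective s
predComp-IsComp (suc (suc b) ∷ r) (_ ∷ ps , s) = s≤s z≤n ∷ ps , suc-injective s

sum-comps-single : ∀ n (F : List ℕ → ℚ) β* → IsComp n β* →
  (∀ β → IsComp n β → β ≢ β* → F β ≡ 0ℚ) → sumℚ (map F (comps n)) ≡ F β*
sum-comps-single zero F [] _ _ = ℚₚ.+-identityʳ (F [])
sum-comps-single zero F (zero ∷ _) (() ∷ _ , _) _
sum-comps-single (suc m) F β* β*-comp F≡0 =
  trans (sumℚ-concatMap F _ (comps m))
  (trans (sumℚ-cong _ G (comps m) successors)
  (trans (sum-comps-single m G (predComp β*) (predComp-IsComp β* β*-comp) G≡0)
         (G-at-pred β* β*-comp F≡0)))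
  where
  incF : List ℕ → ℚ
  incF [] = 0ℚ
  incF (b ∷ r) = F (suc b ∷ r) ℚ.+ 0ℚ
  G : List ℕ → ℚ
  G c = F (1 ∷ c) ℚ.+ incF c
  successors : ∀ c → _ ≡ G c
  successors [] = refl
  successors (b ∷ c) = refl
  G≡0 : ∀ c → IsComp m c → c ≢ predComp β* → G c ≡ 0ℚ
  G≡0 c (ps , s) c≢ =
    trans (cong₂ ℚ._+_ (F≡0 (1 ∷ c) (s≤s z≤n ∷ ps , cong suc s) (c≢ ∘ cong predComp)) (incF≡0 c ps s c≢))
          (ℚₚ.+-identityʳ 0ℚ)
    where
    incF≡0 : ∀ c → All (0 <_) c → sum c ≡ m → c ≢ predComp β* → incF c ≡ 0ℚ
    incF≡0 [] _ _ _ = refl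
    incF≡0 (suc b ∷ r) (_ ∷ ps) s c≢ =
      trans (cong (ℚ._+ 0ℚ) (F≡0 (suc (suc b) ∷ r) (s≤s z≤n ∷ ps , cong suc s) (c≢ ∘ cong predComp)))
            (ℚₚ.+-identityʳ 0ℚ)
  G-at-pred : ∀ β → IsComp (suc m) β → (∀ β′ → IsComp (suc m) β′ → β′ ≢ β → F β′ ≡ 0ℚ) →
    G (predComp β) ≡ F β
  G-at-pred (suc zero ∷ []) _ _ = ℚₚ.+-identityʳ _
  G-at-pred (suc zero ∷ zero ∷ r) (_ ∷ () ∷ _ , _) _
  G-at-pred (suc zero ∷ suc b ∷ r) (_ ∷ _ ∷ ps , s) F≡0′ =
    trans (cong (λ q → F (1 ∷ suc b ∷ r) ℚ.+ (q ℚ.+ 0ℚ)) (F≡0′ _ (s≤s z≤n ∷ ps , s) λ ()))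
          (trans (cong (F (1 ∷ suc b ∷ r) ℚ.+_) (ℚₚ.+-identityʳ 0ℚ)) (ℚₚ.+-identityʳ _))
  G-at-pred (suc (suc b) ∷ r) (_ ∷ ps , s) F≡0′ =
    trans (cong (ℚ._+ (F (suc (suc b) ∷ r) ℚ.+ 0ℚ)) (F≡0′ _ (s≤s z≤n ∷ s≤s z≤n ∷ ps , s) λ ()))
          (trans (ℚₚ.+-identityˡ _) (ℚₚ.+-identityʳ _))

comps-IsComp : ∀ n → All (IsComp n) (comps n)
comps-IsComp zero = ([] , refl) ∷ []
comps-IsComp (suc m) = concat⁺ (map⁺ (All.map successors (comps-IsComp m)))
  where
  successors : ∀ {c} → IsComp m c → All (IsComp (suc m)) ((1 ∷ c) ∷ _)
  successors {[]} (ps , s) = (s≤s z≤n ∷ ps , cong suc s) ∷ []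
  successors {b ∷ r} (p ∷ ps , s) = (s≤s z≤n ∷ p ∷ ps , cong suc s) ∷ (s≤s z≤n ∷ ps , cong suc s) ∷ []

descentComp : ∀ {n} → Permutation′ n → List ℕ
descentComp u = bitsToComp (descentBits (wordOf u))

length-descentBits-wordOf : ∀ {m} (u : Permutation′ (suc m)) → length (descentBits (wordOf u)) ≡ m
length-descentBits-wordOf u =
  trans (length-adjacentBits (λ x y → y <ᵇ x) (wordOf u)) (cong (_∸ 1) (length-tabulate (λ j → suc (toℕ (u ⟨$⟩ʳ j)))))

Y-bits : ∀ {m} β (u : Permutation′ (suc m)) → IsComp (suc m) β →
  Y β u ≡ indicator (descentBits (wordOf u) ⊆ᵇ compToBits β ∧ compToBits β ⊆ᵇ descentBits (wordOf u))
Y-bits {m} β u β-comp = cong indicator (begin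
  subsetᵇ (des w) (compSet β) ∧ subsetᵇ (compSet β) (des w)
    ≡⟨ cong₂ (λ X Y → subsetᵇ X Y ∧ subsetᵇ Y X) (des-descentBits w) compSet-β ⟩
  subsetᵇ (truePositions D) (truePositions C) ∧ subsetᵇ (truePositions C) (truePositions D)
    ≡⟨ cong₂ _∧_ (subsetᵇ-truePositions D C (trans lenD (sym lenC))) (subsetᵇ-truePositions C D (trans lenC (sym lenD))) ⟩
  D ⊆ᵇ C ∧ C ⊆ᵇ D ∎)
  where
  open ≡-Reasoning
  w = wordOf u
  D = descentBits w
  C = compToBits β
  lenD : length D ≡ m
  lenD = length-descentBits-wordOf u
  lenC : length C ≡ m
  lenC = length-compToBits β β-comp
  compSet-β : compSet β ≡ truePositions C
  compSet-β = trans (cong compSet (sym (bitsToComp-compToBits β β-comp))) (compSet-bitsToComp C)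

Y-descentComp : ∀ {m} (u : Permutation′ (suc m)) → Y (descentComp u) u ≡ 1ℚ
Y-descentComp u
  rewrite compSet-bitsToComp (descentBits (wordOf u)) | des-descentBits (wordOf u)
        | subsetᵇ-truePositions (descentBits (wordOf u)) (descentBits (wordOf u)) refl
        | ⊆ᵇ-refl (descentBits (wordOf u)) = refl

Y-≢-descentComp : ∀ {m} β (u : Permutation′ (suc m)) → IsComp (suc m) β → β ≢ descentComp u → Y β u ≡ 0ℚ
Y-≢-descentComp β u β-comp β≢ with descentBits (wordOf u) ⊆ᵇ compToBits β ∧ compToBits β ⊆ᵇ descentBits (wordOf u) in both
    | Y-bits β u β-comp
... | false | Yβ = Yβ
... | true | _ = contradiction β≡ β≢
  where
  β≡ : β ≡ descentComp u
  β≡ = trans (sym (bitsToComp-compToBits β β-comp))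
             (cong bitsToComp (sym (⊆ᵇ-antisym (descentBits (wordOf u)) (compToBits β) lengths both)))
    where
    lengths : length (descentBits (wordOf u)) ≡ length (compToBits β)
    lengths = trans (length-descentBits-wordOf u) (sym (length-compToBits β β-comp))

sumY-descentComp : ∀ m (P : List ℕ → Bool) (u : Permutation′ (suc m)) → sumY (suc m) P u ≡ indicator (P (descentComp u))
sumY-descentComp m P u =
  trans (sum-comps-single (suc m) F (descentComp u) β*-comp F≡0) (at-descentComp (P (descentComp u)) refl)
  where
  F : List ℕ → ℚ
  F β = if P β then Y β u else 0ℚ
  β*-comp : IsComp (suc m) (descentComp u)
  β*-comp = bitsToComp-positive (descentBits (wordOf u)) ,
            trans (sum-bitsToComp (descentBits (wordOf u))) (cong suc (length-descentBits-wordOf u))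
  F≡0 : ∀ β → IsComp (suc m) β → β ≢ descentComp u → F β ≡ 0ℚ
  F≡0 β β-comp β≢ with P β
  ... | true = Y-≢-descentComp β u β-comp β≢
  ... | false = refl
  at-descentComp : ∀ b → P (descentComp u) ≡ b → F (descentComp u) ≡ indicator b
  at-descentComp true Pβ* rewrite Pβ* = Y-descentComp u
  at-descentComp false Pβ* rewrite Pβ* = refl

X-descentComp : ∀ {n} β (u : Permutation′ n) → X β u ≡ indicator (descentComp u ≤C β)
X-descentComp β u =
  cong (λ D → indicator (subsetᵇ D (compSet β)))
       (trans (des-descentBits (wordOf u)) (sym (compSet-bitsToComp (descentBits (wordOf u)))))

Y-descentComp-≤C : ∀ {n} β (u : Permutation′ n) → Y β u ≡ indicator ((descentComp u ≤C β) ∧ (β ≤C descentComp u))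
Y-descentComp-≤C β u = cong (λ D → indicator (subsetᵇ D (compSet β) ∧ subsetᵇ (compSet β) D))
                            (trans (des-descentBits (wordOf u)) (sym (compSet-bitsToComp (descentBits (wordOf u)))))

module Window {m a r} (α-comp : IsSignedComp (suc m) (a ∷ r)) (u : Permutation′ (suc m)) where

  α : List ℤ
  α = a ∷ r

  nz : All Nonzero α
  nz = All.map (λ {a} → nonzero a) (proj₁ α-comp)

  values : List ℕ
  values = List.tabulate (λ j → toℕ (u ⟨$⟩ʳ j))

  wordOf-values : wordOf u ≡ map suc values
  wordOf-values = sym (map-tabulate (λ j → toℕ (u ⟨$⟩ʳ j)) suc)

  length-values : length values ≡ suc m
  length-values = length-tabulate (λ j → toℕ (u ⟨$⟩ʳ j))

  length-signPattern-values : length (signPattern α) ≡ length values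
  length-signPattern-values = trans (length-signPattern α) (trans (proj₂ α-comp) (sym length-values))

  -- the window of the only signed permutation over u that can occur in S_α, T_α or S̃_α
  z : List ℤ
  z = zipWith _◃_ (signPattern α) (map suc values)

  length-z : length z ≡ suc m
  length-z = begin
    length z                   ≡⟨ sym (length-map ∣_∣ z) ⟩
    length (map ∣_∣ z)         ≡⟨ cong length (map-abs-window (signPattern α) values length-signPattern-values) ⟩
    length (map suc values)    ≡⟨ length-map suc values ⟩
    length values              ≡⟨ length-values ⟩
    suc m                      ∎
    where open ≡-Reasoning

  length-gapBits : ∀ (f : Gap → Bool) → length (map f (gaps α)) ≡ m
  length-gapBits f = suc-injective (begin
    suc (length (map f (gaps α))) ≡⟨ cong suc (length-map f (gaps α)) ⟩
    suc (length (gaps α))         ≡⟨ length-gapList ∣_∣ _ _ a r nz ⟩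
    sum (absC α)                  ≡⟨ proj₂ α-comp ⟩
    suc m                         ∎)
    where open ≡-Reasoning

  fitting : AllGaps Fits (gaps α) z
  fitting = AllGaps-Fits (gaps α) (signPattern α) values (pairs-signPattern α nz) (valid-gaps α nz)
              (AllPairs⇒Linked (Unique.tabulate⁺ (λ e → Injection.injective (↔⇒↣ u) (toℕ-injective e))))

  blockCond-window : ∀ R → blockCond R α z ≡ allGapsᵇ (λ g x y → cut g ∨ R x y) (gaps α) z
  blockCond-window R = trans (blockCond-gaps R a r z nz)
    (trans (cong (allGapsᵇ H (gaps α) z ∧_) (signPattern⇒signsMatch α z nz (window-nonzero (signPattern α) values)
                                             (map-sign-window (signPattern α) values length-signPattern-values)))
           (∧-identityʳ (allGapsᵇ H (gaps α) z)))
    where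
    H : Gap → ℤ → ℤ → Bool
    H g x y = cut g ∨ R x y

  φ-window : ∀ R (B : List ℤ → Bool) → (∀ z′ → B z′ ≡ true → blockCond R α z′ ≡ true) →
    φ (λ w → indicator (B (swordOf w))) u ≡ indicator (B z)
  φ-window R B B⇒block = trans (φ-forcedSigns B u (signPattern α) (trans length-signPattern-values length-values) forced)
                                (cong (λ w → indicator (B (zipWith _◃_ (signPattern α) w))) wordOf-values)
    where
    forced : ∀ s → length s ≡ suc m → B (zipWith _◃_ s (wordOf u)) ≡ true → s ≡ signPattern α
    forced s len Bs rewrite wordOf-values = begin
      s                ≡⟨ sym (map-sign-window s values len′) ⟩
      map sign window  ≡⟨ signsMatch⇒signPattern α window nz (window-nonzero s values) length-window matches ⟩
      signPattern α    ∎
      where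
      open ≡-Reasoning
      window = zipWith _◃_ s (map suc values)
      matches : signsMatch α window ≡ true
      matches = ∧-conicalʳ (allGapsᵇ (λ g x y → cut g ∨ R x y) (gaps α) window) _
                           (trans (sym (blockCond-gaps R a r window nz)) (B⇒block window Bs))
      len′ : length s ≡ length values
      len′ = trans len (sym length-values)
      length-window : length (zipWith _◃_ s (map suc values)) ≡ sum (absC α)
      length-window = trans (sym (length-map ∣_∣ window))
                      (trans (cong length (map-abs-window s values len′))
                      (trans (length-map suc values) (trans length-values (sym (proj₂ α-comp)))))

  descentBits-window : descentBits (wordOf u) ≡ adjacentBits descentᵇ z
  descentBits-window = begin
    descentBits (wordOf u)           ≡⟨ cong descentBits wordOf-values ⟩
    descentBits (map suc values)     ≡⟨ cong descentBits (sym (map-abs-window (signPattern α) values length-signPattern-values)) ⟩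
    descentBits (map ∣_∣ z)          ≡⟨ adjacentBits-map (λ x y → y <ᵇ x) ∣_∣ z ⟩
    adjacentBits descentᵇ z          ∎
    where open ≡-Reasoning

  descentComp-≤C : ∀ f → (descentComp u ≤C bitsToComp (map f (gaps α)))
                         ≡ allGapsᵇ (λ g x y → not (descentᵇ x y) ∨ f g) (gaps α) z
  descentComp-≤C f =
    trans (≤C-bitsToComp (descentBits (wordOf u)) (map f (gaps α)) (trans (length-descentBits-wordOf u) (sym (length-gapBits f))))
          (trans (cong (_⊆ᵇ map f (gaps α)) descentBits-window) (adjacentBits-⊆ᵇ descentᵇ f (gaps α) z))

  ≤C-descentComp : ∀ f → (bitsToComp (map f (gaps α)) ≤C descentComp u)
                         ≡ allGapsᵇ (λ g x y → not (f g) ∨ descentᵇ x y) (gaps α) z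
  ≤C-descentComp f =
    trans (≤C-bitsToComp (map f (gaps α)) (descentBits (wordOf u)) (trans (length-gapBits f) (sym (length-descentBits-wordOf u))))
          (trans (cong (map f (gaps α) ⊆ᵇ_) descentBits-window) (⊆ᵇ-adjacentBits descentᵇ f (gaps α) z))

  runs-window : eqListᵇ (map length (runs stepᵇ z)) (absC α)
              ≡ allGapsᵇ (λ g x y → not (not (stepᵇ x y)) ∨ cut g) (gaps α) z
                ∧ allGapsᵇ (λ g x y → not (cut g) ∨ not (stepᵇ x y)) (gaps α) z
  runs-window with z | length-z
  ... | x ∷ xs | len = begin
    eqListᵇ (map length (runs stepᵇ (x ∷ xs))) (absC α)
      ≡⟨ cong₂ eqListᵇ (map-length-runs stepᵇ x xs) (absC-gaps a r nz) ⟩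
    eqListᵇ (bitsToComp runBits) (bitsToComp (map cut (gaps α)))
      ≡⟨ eqListᵇ-bitsToComp runBits (map cut (gaps α))
           (trans (length-adjacentBits _ (x ∷ xs)) (trans (cong (_∸ 1) len) (sym (length-gapBits cut)))) ⟩
    runBits ⊆ᵇ map cut (gaps α) ∧ map cut (gaps α) ⊆ᵇ runBits
      ≡⟨ cong₂ _∧_ (adjacentBits-⊆ᵇ _ cut (gaps α) (x ∷ xs)) (⊆ᵇ-adjacentBits _ cut (gaps α) (x ∷ xs)) ⟩
    _ ∎
    where
    open ≡-Reasoning
    runBits = adjacentBits (λ y z → not (stepᵇ y z)) (x ∷ xs)

  φ-S : φ (S α) u ≡ X (absC α) u
  φ-S = begin
    φ (S α) u
      ≡⟨ φ-window Rabs (blockCond Rabs α) (λ _ block → block) ⟩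
    indicator (blockCond Rabs α z)
      ≡⟨ cong indicator (blockCond-window Rabs) ⟩
    indicator (allGapsᵇ (λ g x y → cut g ∨ Rabs x y) (gaps α) z)
      ≡⟨ cong indicator (allGapsᵇ-cong _ _ (gaps α) z gap-S fitting) ⟩
    indicator (allGapsᵇ (λ g x y → not (descentᵇ x y) ∨ cut g) (gaps α) z)
      ≡⟨ cong indicator (sym (trans (cong (descentComp u ≤C_) (absC-gaps a r nz)) (descentComp-≤C cut))) ⟩
    indicator (descentComp u ≤C absC α)
      ≡⟨ sym (X-descentComp (absC α) u) ⟩
    X (absC α) u ∎
    where
    open ≡-Reasoning
    Rabs : ℤ → ℤ → Bool
    Rabs x y = ∣ x ∣ <ᵇ ∣ y ∣

  φ-T : φ (T α) u ≡ sumY (suc m) (λ β → (under α ≤C β) ∧ (β ≤C absC α)) u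
  φ-T = begin
    φ (T α) u
      ≡⟨ φ-window Rabs B (λ _ → ∧-conicalˡ _ _) ⟩
    indicator (blockCond Rabs α z ∧ eqListᵇ (map length (runs stepᵇ z)) (absC α))
      ≡⟨ cong indicator (cong₂ _∧_ (blockCond-window Rabs) runs-window) ⟩
    indicator (allGapsᵇ F₁ (gaps α) z ∧ (allGapsᵇ F₂ (gaps α) z ∧ allGapsᵇ F₃ (gaps α) z))
      ≡⟨ cong indicator (trans (cong (allGapsᵇ F₁ (gaps α) z ∧_) (allGapsᵇ-∧ F₂ F₃ (gaps α) z))
                               (allGapsᵇ-∧ F₁ _ (gaps α) z)) ⟩
    indicator (allGapsᵇ (λ g x y → F₁ g x y ∧ (F₂ g x y ∧ F₃ g x y)) (gaps α) z)
      ≡⟨ cong indicator (allGapsᵇ-cong _ _ (gaps α) z gap-T fitting) ⟩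
    indicator (allGapsᵇ (λ g x y → G₁ g x y ∧ G₂ g x y) (gaps α) z)
      ≡⟨ cong indicator (sym (allGapsᵇ-∧ G₁ G₂ (gaps α) z)) ⟩
    indicator (allGapsᵇ G₁ (gaps α) z ∧ allGapsᵇ G₂ (gaps α) z)
      ≡⟨ cong indicator (sym (cong₂ _∧_ (trans (cong (_≤C descentComp u) (under-gaps a r nz)) (≤C-descentComp underBit))
                                         (trans (cong (descentComp u ≤C_) (absC-gaps a r nz)) (descentComp-≤C cut)))) ⟩
    indicator ((under α ≤C descentComp u) ∧ (descentComp u ≤C absC α))
      ≡⟨ sym (sumY-descentComp m (λ β → (under α ≤C β) ∧ (β ≤C absC α)) u) ⟩
    sumY (suc m) (λ β → (under α ≤C β) ∧ (β ≤C absC α)) u ∎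
    where
    open ≡-Reasoning
    Rabs : ℤ → ℤ → Bool
    Rabs x y = ∣ x ∣ <ᵇ ∣ y ∣
    B : List ℤ → Bool
    B z′ = blockCond Rabs α z′ ∧ eqListᵇ (map length (runs stepᵇ z′)) (absC α)
    F₁ F₂ F₃ G₁ G₂ : Gap → ℤ → ℤ → Bool
    F₁ g x y = cut g ∨ Rabs x y
    F₂ g x y = not (not (stepᵇ x y)) ∨ cut g
    F₃ g x y = not (cut g) ∨ not (stepᵇ x y)
    G₁ g x y = not (underBit g) ∨ descentᵇ x y
    G₂ g x y = not (descentᵇ x y) ∨ cut g

  φ-St : φ (St α) u ≡ sumY (suc m) (λ β → (U α ≤C β) ∧ (β ≤C O α)) u
  φ-St = begin
    φ (St α) u
      ≡⟨ φ-window ltℤ (blockCond ltℤ α) (λ _ block → block) ⟩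
    indicator (blockCond ltℤ α z)
      ≡⟨ cong indicator (blockCond-window ltℤ) ⟩
    indicator (allGapsᵇ (λ g x y → cut g ∨ ltℤ x y) (gaps α) z)
      ≡⟨ cong indicator (allGapsᵇ-cong _ _ (gaps α) z gap-St fitting) ⟩
    indicator (allGapsᵇ (λ g x y → G₁ g x y ∧ G₂ g x y) (gaps α) z)
      ≡⟨ cong indicator (sym (allGapsᵇ-∧ G₁ G₂ (gaps α) z)) ⟩
    indicator (allGapsᵇ G₁ (gaps α) z ∧ allGapsᵇ G₂ (gaps α) z)
      ≡⟨ cong indicator (sym (cong₂ _∧_ (trans (cong (_≤C descentComp u) (U-gaps a r nz)) (≤C-descentComp UBit))
                                         (trans (cong (descentComp u ≤C_) (O-gaps a r nz)) (descentComp-≤C OBit)))) ⟩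
    indicator ((U α ≤C descentComp u) ∧ (descentComp u ≤C O α))
      ≡⟨ sym (sumY-descentComp m (λ β → (U α ≤C β) ∧ (β ≤C O α)) u) ⟩
    sumY (suc m) (λ β → (U α ≤C β) ∧ (β ≤C O α)) u ∎
    where
    open ≡-Reasoning
    G₁ G₂ : Gap → ℤ → ℤ → Bool
    G₁ g x y = not (UBit g) ∨ descentᵇ x y
    G₂ g x y = not (descentᵇ x y) ∨ OBit g

positive : List ℕ → List ℤ
positive = map (λ k → + k)

alternating : Bool → List ℕ → List ℤ
alternating b [] = []
alternating b (k ∷ β) = (if b then + k else ℤ.- (+ k)) ∷ alternating (not b) β

absC-positive : ∀ β → absC (positive β) ≡ β
absC-positive β = trans (sym (map-∘ β)) (map-id β)

absC-alternating : ∀ b β → absC (alternating b β) ≡ β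
absC-alternating b [] = refl
absC-alternating true (k ∷ β) = cong (k ∷_) (absC-alternating false β)
absC-alternating false (zero ∷ β) = cong (0 ∷_) (absC-alternating true β)
absC-alternating false (suc k ∷ β) = cong (suc k ∷_) (absC-alternating true β)

positive-IsSignedComp : ∀ {n} β → IsComp n β → IsSignedComp n (positive β)
positive-IsSignedComp β (ps , s) = map⁺ (All.map (λ { {suc _} _ () }) ps) , trans (cong sum (absC-positive β)) s

alternating-IsSignedComp : ∀ {n} β → IsComp n β → IsSignedComp n (alternating true β)
alternating-IsSignedComp β (ps , s) = nonzeros true β ps , trans (cong sum (absC-alternating true β)) s
  where
  nonzeros : ∀ b β → All (0 <_) β → All (_≢ + 0) (alternating b β)
  nonzeros b [] [] = []
  nonzeros true (suc k ∷ β) (_ ∷ ps) = (λ ()) ∷ nonzeros false β ps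
  nonzeros false (suc k ∷ β) (_ ∷ ps) = (λ ()) ∷ nonzeros true β ps

under-positive : ∀ β → All (0 <_) β → under (positive β) ≡ β
under-positive β ps = begin
  map (λ I → sum (map ∣_∣ I)) (runs R (positive β))
    ≡⟨ cong (map (λ I → sum (map ∣_∣ I))) (runs-antichain R (positive β) (antichain β ps)) ⟩
  map (λ I → sum (map ∣_∣ I)) (map (_∷ []) (positive β)) ≡⟨ sym (map-∘ (positive β)) ⟩
  map (λ a → ∣ a ∣ + 0) (positive β)                      ≡⟨ sym (map-∘ β) ⟩
  map (λ b → b + 0) β                                     ≡⟨ map-cong +-identityʳ β ⟩
  map (λ b → b) β                                         ≡⟨ map-id β ⟩
  β                                                       ∎
  where
  open ≡-Reasoning
  R : ℤ → ℤ → Bool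
  R a b = not (sameSignᵇ a b)
  antichain : ∀ β → All (0 <_) β → chain (λ x y → not (R x y)) (positive β) ≡ true
  antichain [] _ = refl
  antichain (k ∷ []) _ = refl
  antichain (suc k ∷ zero ∷ β) (_ ∷ () ∷ _)
  antichain (suc k ∷ suc j ∷ β) (_ ∷ ps) = antichain (suc j ∷ β) ps

chain-alternating : ∀ b β → All (0 <_) β → chain (λ a b → not (sameSignᵇ a b)) (alternating b β) ≡ true
chain-alternating b [] _ = refl
chain-alternating b (k ∷ []) _ = refl
chain-alternating b (suc k ∷ zero ∷ β) (_ ∷ () ∷ _)
chain-alternating true (suc k ∷ suc j ∷ β) (_ ∷ ps) = chain-alternating false (suc j ∷ β) ps
chain-alternating false (suc k ∷ suc j ∷ β) (_ ∷ ps) = chain-alternating true (suc j ∷ β) ps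

compSet-under-alternating : ∀ b β → All (0 <_) β → compSet (under (alternating b β)) ≡ []
compSet-under-alternating b [] _ = refl
compSet-under-alternating b (k ∷ β) ps
  rewrite runs-chain (λ a b → not (sameSignᵇ a b)) _ (alternating (not b) β) (chain-alternating b (k ∷ β) ps) = refl

φ-T-positive : ∀ {m} β (u : Permutation′ (suc m)) → IsComp (suc m) β → φ (T (positive β)) u ≡ Y β u
φ-T-positive {m} [] u (_ , ())
φ-T-positive {m} (b ∷ β) u β-comp = begin
  φ (T (positive (b ∷ β))) u
    ≡⟨ Window.φ-T (positive-IsSignedComp (b ∷ β) β-comp) u ⟩
  sumY (suc m) (λ γ → (under (positive (b ∷ β)) ≤C γ) ∧ (γ ≤C absC (positive (b ∷ β)))) u
    ≡⟨ sumY-descentComp m (λ γ → (under (positive (b ∷ β)) ≤C γ) ∧ (γ ≤C absC (positive (b ∷ β)))) u ⟩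
  indicator ((under (positive (b ∷ β)) ≤C descentComp u) ∧ (descentComp u ≤C absC (positive (b ∷ β))))
    ≡⟨ cong₂ (λ γ γ′ → indicator ((γ ≤C descentComp u) ∧ (descentComp u ≤C γ′)))
             (under-positive (b ∷ β) (proj₁ β-comp)) (absC-positive (b ∷ β)) ⟩
  indicator (((b ∷ β) ≤C descentComp u) ∧ (descentComp u ≤C (b ∷ β)))
    ≡⟨ cong indicator (∧-comm ((b ∷ β) ≤C descentComp u) _) ⟩
  indicator ((descentComp u ≤C (b ∷ β)) ∧ ((b ∷ β) ≤C descentComp u))
    ≡⟨ sym (Y-descentComp-≤C (b ∷ β) u) ⟩
  Y (b ∷ β) u ∎
  where open ≡-Reasoning

φ-T-alternating : ∀ {m} β (u : Permutation′ (suc m)) → IsComp (suc m) β → φ (T (alternating true β)) u ≡ X β u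
φ-T-alternating {m} [] u (_ , ())
φ-T-alternating {m} (b ∷ β) u β-comp = begin
  φ (T (alternating true (b ∷ β))) u
    ≡⟨ Window.φ-T (alternating-IsSignedComp (b ∷ β) β-comp) u ⟩
  sumY (suc m) (λ γ → (under (alternating true (b ∷ β)) ≤C γ) ∧ (γ ≤C absC (alternating true (b ∷ β)))) u
    ≡⟨ sumY-descentComp m (λ γ → (under (alternating true (b ∷ β)) ≤C γ) ∧ (γ ≤C absC (alternating true (b ∷ β)))) u ⟩
  indicator ((under (alternating true (b ∷ β)) ≤C descentComp u) ∧ (descentComp u ≤C absC (alternating true (b ∷ β))))
    ≡⟨ cong₂ (λ S γ → indicator (subsetᵇ S (compSet (descentComp u)) ∧ (descentComp u ≤C γ)))
             (compSet-under-alternating true (b ∷ β) (proj₁ β-comp)) (absC-alternating true (b ∷ β)) ⟩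
  indicator (descentComp u ≤C (b ∷ β))
    ≡⟨ sym (X-descentComp (b ∷ β) u) ⟩
  X (b ∷ β) u ∎
  where open ≡-Reasoning

φ-linear : ∀ {n} {A : Set} (c : A → ℚ) (x : A → QB n) L (u : Permutation′ n) →
  φ (λ w → sumℚ (map (λ p → c p ℚ.* x p w) L)) u ≡ sumℚ (map (λ p → c p ℚ.* φ (x p) u) L)
φ-linear {n} c x L u =
  trans (sumℚ-swap (λ ε p → c p ℚ.* x p (ε , u)) (allSigns n) L)
        (sumℚ-cong _ _ L (λ p → sumℚ-*ˡ (c p) (λ ε → x p (ε , u)) (allSigns n)))

scaled-sumY : ∀ n q (P : List ℕ → Bool) (u : Permutation′ n) →
  sumℚ (map (λ p → proj₁ p ℚ.* Y (proj₂ p) u) (map (λ β → (if P β then q else 0ℚ) , β) (comps n)))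
  ≡ q ℚ.* sumY n P u
scaled-sumY n q P u = trans (cong sumℚ (sym (map-∘ (comps n))))
                            (trans (sumℚ-cong _ _ (comps n) select) (sumℚ-*ˡ q _ (comps n)))
  where
  select : ∀ β → (if P β then q else 0ℚ) ℚ.* Y β u ≡ q ℚ.* (if P β then Y β u else 0ℚ)
  select β with P β
  ... | true = refl
  ... | false = trans (ℚₚ.*-zeroˡ (Y β u)) (sym (ℚₚ.*-zeroʳ q))

φ-Ω⊆Σ : ∀ m (x : QB (suc m)) → InΩ (suc m) x → InΣ (suc m) (φ x)
φ-Ω⊆Σ m x (L , L-comps , x≡) = L′ , [] , L′-comps , [] , φx≡
  where
  n = suc m
  interval : List ℤ → List ℕ → Bool
  interval α β = (under α ≤C β) ∧ (β ≤C absC α)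
  expand : ℚ × List ℤ → List (ℚ × List ℕ)
  expand (q , α) = map (λ β → (if interval α β then q else 0ℚ) , β) (comps n)
  L′ = List.concatMap expand L
  L′-comps : All (λ p → IsComp n (proj₂ p)) L′
  L′-comps = concat⁺ (map⁺ (All.map (λ _ → map⁺ (comps-IsComp n)) L-comps))
  φx≡ : ∀ u → φ x u ≡ sumℚ (map (λ p → proj₁ p ℚ.* Y (proj₂ p) u) L′)
                       ℚ.+ sumℚ (map (λ p → proj₁ p ℚ.* X (proj₂ p) u) [])
  φx≡ u = begin
    φ x u
      ≡⟨ sumℚ-cong _ _ (allSigns n) (λ ε → x≡ (ε , u)) ⟩
    φ (λ w → sumℚ (map (λ p → proj₁ p ℚ.* T (proj₂ p) w) L)) u
      ≡⟨ φ-linear proj₁ (T ∘ proj₂) L u ⟩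
    sumℚ (map (λ p → proj₁ p ℚ.* φ (T (proj₂ p)) u) L)
      ≡⟨ sumℚ-congᴬ _ _ L L-comps (λ {p} α-comp → cong (proj₁ p ℚ.*_) (φ-T′ (proj₂ p) α-comp)) ⟩
    sumℚ (map (λ p → proj₁ p ℚ.* sumY n (interval (proj₂ p)) u) L)
      ≡⟨ sumℚ-cong _ _ L (λ p → sym (scaled-sumY n (proj₁ p) (interval (proj₂ p)) u)) ⟩
    sumℚ (map (λ p → sumℚ (map (λ p′ → proj₁ p′ ℚ.* Y (proj₂ p′) u) (expand p))) L)
      ≡⟨ sym (sumℚ-concatMap _ expand L) ⟩
    sumℚ (map (λ p → proj₁ p ℚ.* Y (proj₂ p) u) L′)
      ≡⟨ sym (ℚₚ.+-identityʳ _) ⟩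
    sumℚ (map (λ p → proj₁ p ℚ.* Y (proj₂ p) u) L′) ℚ.+ 0ℚ ∎
    where
    open ≡-Reasoning
    φ-T′ : ∀ α → IsSignedComp n α → φ (T α) u ≡ sumY n (interval α) u
    φ-T′ [] (_ , ())
    φ-T′ (a ∷ r) α-comp = Window.φ-T α-comp u

φ-onto-Σ : ∀ m (y : QS (suc m)) → InΣ (suc m) y → Σ (QB (suc m)) λ x → InΩ (suc m) x × (∀ u → φ x u ≡ y u)
φ-onto-Σ m y (L , M , L-comps , M-comps , y≡) = x , (LΩ , LΩ-comps , λ _ → refl) , φx≡
  where
  n = suc m
  toPositive toAlternating : ℚ × List ℕ → ℚ × List ℤ
  toPositive (q , β) = q , positive β
  toAlternating (q , β) = q , alternating true β
  LΩ : List (ℚ × List ℤ)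
  LΩ = map toPositive L ++ map toAlternating M
  x : QB n
  x w = sumℚ (map (λ p → proj₁ p ℚ.* T (proj₂ p) w) LΩ)
  LΩ-comps : All (λ p → IsSignedComp n (proj₂ p)) LΩ
  LΩ-comps = ++⁺ (map⁺ (All.map (positive-IsSignedComp _) L-comps)) (map⁺ (All.map (alternating-IsSignedComp _) M-comps))
  φx≡ : ∀ u → φ x u ≡ y u
  φx≡ u = begin
    φ x u
      ≡⟨ φ-linear proj₁ (T ∘ proj₂) LΩ u ⟩
    sumℚ (map F LΩ)
      ≡⟨ sumℚ-++ F (map toPositive L) (map toAlternating M) ⟩
    sumℚ (map F (map toPositive L)) ℚ.+ sumℚ (map F (map toAlternating M))
      ≡⟨ cong₂ ℚ._+_
           (trans (cong sumℚ (sym (map-∘ L)))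
                  (sumℚ-congᴬ _ _ L L-comps (λ {p} β-comp → cong (proj₁ p ℚ.*_) (φ-T-positive (proj₂ p) u β-comp))))
           (trans (cong sumℚ (sym (map-∘ M)))
                  (sumℚ-congᴬ _ _ M M-comps (λ {p} β-comp → cong (proj₁ p ℚ.*_) (φ-T-alternating (proj₂ p) u β-comp)))) ⟩
    sumℚ (map (λ p → proj₁ p ℚ.* Y (proj₂ p) u) L) ℚ.+ sumℚ (map (λ p → proj₁ p ℚ.* X (proj₂ p) u) M)
      ≡⟨ sym (y≡ u) ⟩
    y u ∎
    where
    open ≡-Reasoning
    F : ℚ × List ℤ → ℚ
    F p = proj₁ p ℚ.* φ (T (proj₂ p)) u

proposition7p5 : (n : ℕ) → 1 ≤ n →
    ((α : List ℤ) → IsSignedComp n α →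
      (∀ u → φ (S {n} α) u ≡ X {n} (absC α) u) ×
      (∀ u → φ (T {n} α) u ≡ sumY n (λ β → (under α ≤C β) ∧ (β ≤C absC α)) u) ×
      (∀ u → φ (St {n} α) u ≡ sumY n (λ β → (U α ≤C β) ∧ (β ≤C O α)) u)) ×
    ((x : QB n) → InΩ n x → InΣ n (φ x)) ×
    ((y : QS n) → InΣ n y → Σ (QB n) λ x → InΩ n x × (∀ u → φ x u ≡ y u))
proposition7p5 (suc m) _ = formulas , φ-Ω⊆Σ m , φ-onto-Σ m
  where
  formulas : (α : List ℤ) → IsSignedComp (suc m) α →
    (∀ u → φ (S α) u ≡ X (absC α) u) ×
    (∀ u → φ (T α) u ≡ sumY (suc m) (λ β → (under α ≤C β) ∧ (β ≤C absC α)) u) ×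
    (∀ u → φ (St α) u ≡ sumY (suc m) (λ β → (U α ≤C β) ∧ (β ≤C O α)) u)
  formulas [] (_ , ())
  formulas (a ∷ r) α-comp = Window.φ-S α-comp , Window.φ-T α-comp , Window.φ-St α-comp
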